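{- Let $N^*,P^*:\mathcal H_K^{gr}\to\mathcal H_K^{gr}$ be the transposes of $N$ and $P$, i.e. $\langle N^*w,u\rangle=\langle w,N(u)\rangle$ and $\langle P^*w,u\rangle=\langle w,P(u)\rangle$. Then: (1) $N^*(Z_\bullet)=0$; for rooted trees $t$ with $|t|\ge2$, $N^*(Z_t)=\sum_{|t'|=|t|-1}n(t';t)\,Z_{t'}$; and for $w,v\in\mathcal H_K^{gr}$ with $v$ homogeneous of degree $|v|$, $$N^*(wv)=(N^*w)v+w(N^*v)+\frac{\partial w}{\partial Z_\bullet}\,|v|\,v.$$ (2) $P^*(w)=Z_\bullet w$ for all $w\in\mathcal H_K^{gr}$.
   Context: A rooted tree is a finite partially ordered set (elements called vertices) with a unique greatest element, the root, such that for every vertex $v$ the set of vertices greater than $v$ is a chain; if $v$ covers $w$, $w$ is a child of $v$. We regard it as a directed graph with edges from each vertex to its children; a vertex is terminal if it has no children. Rooted trees are considered up to isomorphism; $|t|$ is the number of vertices, $\bullet$ the one-vertex tree. Write $t\lhd t'$ if $t$ is obtained from $t'$ by deleting one terminal non-root vertex and the edge into it. For $t\lhd t'$, $n(t;t')$ is the number of vertices of $t$ at which attaching a new edge to a new terminal vertex yields $t'$ (and $n(t';t)=0$ if $t'\lhd t$ fails), and $m(t;t')$ is the number of edges of $t'$ whose removal (with their terminal endpoint) leaves $t$. $\mathcal H_K$ is the polynomial algebra over a field $k$ of characteristic $0$ generated by the rooted trees, graded by $\deg t=|t|$. $B_+$ is the linear map from $\mathcal H_K$ to the span of rooted trees sending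 a monomial $t_1\cdots t_n$ to the tree obtained by adding a new root joined by new edges to the roots of the $t_i$, with $B_+(1)=\bullet$; $B_-$ is its inverse. $\mathcal H_K$ is a Hopf algebra with counit killing positive degree, coproduct $\Delta(1)=1\otimes1$, $\Delta(t)=t\otimes1+(\mathrm{id}\otimes B_+)\Delta(B_-(t))$ for rooted trees $t$, extended multiplicatively. $N$ is the derivation of $\mathcal H_K$ with $N(t)=\sum_{t\lhd t'}n(t;t')t'$; $P$ is the derivation with $P(t)=\sum_{t'\lhd t}m(t';t)t'$ for $|t|\ge2$ and $P(\bullet)=1$. $\mathcal H_K^{gr}$ is the graded dual of $\mathcal H_K$ with pairing $\langle\cdot,\cdot\rangle$ and multiplication dual to $\Delta$: $\langle wv,u\rangle=\langle w\otimes v,\Delta(u)\rangle$. For a rooted tree $t$, $Z_t\in\mathcal H_K^{gr}$ is defined by $\langle Z_t,u\rangle=\delta_{t,u}$ for all monomials $u$ of $\mathcal H_K$. $\frac{\partial}{\partial Z_\bullet}$ denotes the transpose of multiplication by $\bullet$ on $\mathcal H_K$: $\langle\frac{\partial w}{\partial Z_\bullet},u\rangle=\langle w,\bullet u\rangle$. -}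

module Defs where

open import Level using (_⊔_)
open import Data.Bool using (Bool; true; false; if_then_else_; _∧_; not)
import Data.Bool
open import Data.Nat using (ℕ; zero; suc; _∸_; _<_; _≤_)
import Data.Nat as ℕ
open import Data.List using (List; []; _∷_; _++_; [_]; map; concatMap; filter; length; upTo)
open import Data.Product using (_×_; _,_; ∃-syntax; Σ-syntax)
open import Relation.Nullary using (¬_)
open import Relation.Binary.PropositionalEquality using (_≡_)
open import Relation.Nullary.Decidable using (does)
open import Algebra.Bundles using (CommutativeRing)

-- A (planar) representative of a rooted tree: a root with an ordered list
-- of subtrees.  Rooted trees in the paper are taken up to isomorphism; two
-- representatives are isomorphic iff they have the same canonical form
-- (children recursively sorted), see `_≅ᵇ_` below.

data Tree : Set where
  node : List Tree → Tree

-- monomials of H_K (products of trees, i.e. forests); [] is the unit 1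
Forest : Set
Forest = List Tree

• : Tree
• = node []

mutual
  size : Tree → ℕ
  size (node ts) = suc (sizeF ts)

  sizeF : Forest → ℕ
  sizeF [] = 0
  sizeF (t ∷ ts) = size t ℕ.+ sizeF ts

deg : Forest → ℕ
deg = sizeF

mutual
  code : Tree → List Bool
  code (node ts) = true ∷ codeF ts ++ [ false ]

  codeF : Forest → List Bool
  codeF [] = []
  codeF (t ∷ ts) = code t ++ codeF ts

leqB : List Bool → List Bool → Bool
leqB [] _ = true
leqB (_ ∷ _) [] = false
leqB (false ∷ xs) (true ∷ ys) = true
leqB (true ∷ xs) (false ∷ ys) = false
leqB (false ∷ xs) (false ∷ ys) = leqB xs ys
leqB (true ∷ xs) (true ∷ ys) = leqB xs ys

eqB : List Bool → List Bool → Bool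
eqB [] [] = true
eqB (true ∷ xs) (true ∷ ys) = eqB xs ys
eqB (false ∷ xs) (false ∷ ys) = eqB xs ys
eqB _ _ = false

insertT : Tree → Forest → Forest
insertT t [] = [ t ]
insertT t (s ∷ ss) = if leqB (code t) (code s) then t ∷ s ∷ ss else s ∷ insertT t ss

sortT : Forest → Forest
sortT [] = []
sortT (t ∷ ts) = insertT t (sortT ts)

mutual
  canon : Tree → Tree
  canon (node ts) = node (canonF ts)

  canonF : Forest → Forest
  canonF ts = sortT (canonL ts)

  canonL : Forest → Forest
  canonL [] = []
  canonL (t ∷ ts) = canon t ∷ canonL ts

_≅ᵇ_ : Tree → Tree → Bool
t ≅ᵇ s = eqB (code (canon t)) (code (canon s))

_≅Fᵇ_ : Forest → Forest → Bool
f ≅Fᵇ g = eqB (codeF (canonF f)) (codeF (canonF g))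

-- all planar trees / planar forests of a given size (the first argument
-- is fuel; 3 * n is sufficient for size n)
mutual
  planarTrees : ℕ → ℕ → List Tree
  planarTrees zero _ = []
  planarTrees (suc f) zero = []
  planarTrees (suc f) (suc m) = map node (planarForests f m)

  planarForests : ℕ → ℕ → List Forest
  planarForests _ zero = [ [] ]
  planarForests zero (suc m) = []
  planarForests (suc f) (suc m) =
    concatMap (λ k → concatMap (λ t → map (t ∷_) (planarForests f (suc m ∸ suc k)))
                               (planarTrees f (suc k)))
              (upTo (suc m))

-- one representative (the canonical one) of each isomorphism class of
-- rooted trees with n vertices
treesOfSize : ℕ → List Tree
treesOfSize n = filter (λ t → eqB (code t) (code (canon t)) Data.Bool.≟ true)
                       (planarTrees (3 ℕ.* n) n)

mutual
  graftings : Tree → List Tree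
  graftings (node ts) = node (ts ++ [ • ]) ∷ map node (graftingsF ts)

  graftingsF : Forest → List Forest
  graftingsF [] = []
  graftingsF (t ∷ ts) = map (_∷ ts) (graftings t) ++ map (t ∷_) (graftingsF ts)

isTerminal : Tree → Bool
isTerminal (node []) = true
isTerminal (node (_ ∷ _)) = false

mutual
  prunings : Tree → List Tree
  prunings (node ts) = map node (pruningsF ts)

  pruningsF : Forest → List Forest
  pruningsF [] = []
  pruningsF (t ∷ ts) =
    (if isTerminal t then [ ts ] else [])
    ++ map (_∷ ts) (prunings t) ++ map (t ∷_) (pruningsF ts)

count : (Tree → Bool) → List Tree → ℕ
count p [] = 0
count p (x ∷ xs) = if p x then suc (count p xs) else count p xs

nCoef : Tree → Tree → ℕ
nCoef t t' = count (λ s → s ≅ᵇ t') (graftings t)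

mCoef : Tree → Tree → ℕ
mCoef t t' = count (λ s → s ≅ᵇ t) (prunings t')

LC : Set
LC = List (ℕ × Forest)

Ntree : Tree → LC
Ntree t = map (λ t' → nCoef t t' , [ t' ]) (treesOfSize (suc (size t)))

Ptree : Tree → LC
Ptree (node []) = [ (1 , []) ]
Ptree t@(node (_ ∷ _)) = map (λ t' → mCoef t' t , [ t' ]) (treesOfSize (size t ∸ 1))

derivation : (Tree → LC) → Forest → LC
derivation D [] = []
derivation D (t ∷ ts) =
  map (λ { (c , g) → c , g ++ ts }) (D t) ++ map (λ { (c , g) → c , t ∷ g }) (derivation D ts)

N : Forest → LC
N = derivation Ntree

P : Forest → LC
P = derivation Ptree

-- coproduct: Δ(t) = t ⊗ 1 + (id ⊗ B₊) Δ(B₋(t)), extended multiplicatively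
-- (a list of terms a ⊗ b, each with coefficient 1)
mutual
  Δt : Tree → List (Forest × Forest)
  Δt (node ts) = ([ node ts ] , []) ∷ map (λ { (a , b) → a , [ node b ] }) (Δ ts)

  Δ : Forest → List (Forest × Forest)
  Δ [] = [ ([] , []) ]
  Δ (t ∷ ts) = concatMap (λ { (a , b) → map (λ { (a' , b') → a ++ a' , b ++ b' }) (Δ ts) }) (Δt t)

natK : ∀ {c ℓ} (K : CommutativeRing c ℓ) → ℕ → CommutativeRing.Carrier K
natK K zero = CommutativeRing.0# K
natK K (suc n) = CommutativeRing._+_ K (CommutativeRing.1# K) (natK K n)

record IsField0 {c ℓ} (K : CommutativeRing c ℓ) : Set (c ⊔ ℓ) where
  open CommutativeRing K
  field
    1≉0      : ¬ (1# ≈ 0#)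
    inverse  : ∀ x → ¬ (x ≈ 0#) → ∃[ y ] (x * y ≈ 1#)
    charZero : ∀ n → ¬ (natK K (suc n) ≈ 0#)

-- An element w is given by its values on monomials; ⟪ w , u ⟫ is the
-- pairing with a monomial u (well defined on isomorphism classes, since u
-- is first put into canonical form).  Since each graded piece of H_K is
-- finite-dimensional, an element of H_K^gr is exactly such a functional
-- vanishing on monomials of large degree (predicate `IsGraded`).

module Dual {c ℓ} (K : CommutativeRing c ℓ) where
  open CommutativeRing K

  infix 4 _≐_
  infixl 6 _⊕_
  infixl 7 _⋆_
  infixr 8 _·_

  Fn : Set c
  Fn = Forest → Carrier

  ⟪_,_⟫ : Fn → Forest → Carrier
  ⟪ w , u ⟫ = w (canonF u)

  ⟪_,_⟫ᴸ : Fn → LC → Carrier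
  ⟪ w , [] ⟫ᴸ = 0#
  ⟪ w , (n , u) ∷ l ⟫ᴸ = (natK K n * ⟪ w , u ⟫) + ⟪ w , l ⟫ᴸ

  _≐_ : Fn → Fn → Set ℓ
  w ≐ w' = ∀ u → ⟪ w , u ⟫ ≈ ⟪ w' , u ⟫

  IsGraded : Fn → Set ℓ
  IsGraded w = ∃[ D ] (∀ u → D < deg u → ⟪ w , u ⟫ ≈ 0#)

  Homogeneous : ℕ → Fn → Set ℓ
  Homogeneous d v = ∀ u → ¬ (deg u ≡ d) → ⟪ v , u ⟫ ≈ 0#

  0ᴰ : Fn
  0ᴰ _ = 0#

  _⊕_ : Fn → Fn → Fn
  (w ⊕ v) u = ⟪ w , u ⟫ + ⟪ v , u ⟫

  _·_ : Carrier → Fn → Fn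
  (a · v) u = a * ⟪ v , u ⟫

  _⋆_ : Fn → Fn → Fn
  (w ⋆ v) u = sumΔ (Δ u)
    where
    sumΔ : List (Forest × Forest) → Carrier
    sumΔ [] = 0#
    sumΔ ((a , b) ∷ l) = (⟪ w , a ⟫ * ⟪ v , b ⟫) + sumΔ l

  Z : Tree → Fn
  Z t u = if u ≅Fᵇ [ t ] then 1# else 0#

  N* : Fn → Fn
  N* w u = ⟪ w , N u ⟫ᴸ

  P* : Fn → Fn
  P* w u = ⟪ w , P u ⟫ᴸ

  -- ∂/∂Z_• : transpose of multiplication by •
  ∂/∂Z• : Fn → Fn
  ∂/∂Z• w u = ⟪ w , • ∷ u ⟫

  ΣnZ : Tree → Fn
  ΣnZ t = go (treesOfSize (size t ∸ 1))
    where
    go : List Tree → Fn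
    go [] = 0ᴰ
    go (t' ∷ ts) = (natK K (nCoef t' t) · Z t') ⊕ go ts

{-# OPTIONS --safe #-}
module Submission where

open import Defs
open import Level using (Level)
open import Data.Nat using (ℕ; _≤_; _∸_)
open import Data.Product using (_×_)
open import Algebra.Bundles using (CommutativeRing)
open import Algebra.Bundles using (CommutativeSemiring)
open import Data.Product using (_,_)

-- An element of the graded dual pairs with a monomial through its canonical form, so the
-- main preliminary is that summing an isomorphism-invariant functional over the graftings,
-- the prunings or the coproduct terms of a planar forest depends only on its isomorphism
-- class.  Since `treesOfSize` lists each class exactly once, N u and P u then pair like
-- the lists of graftings and prunings of u, and the statements become identities of
-- planar forests: pairing Z_• ⊗ id with Δ u selects exactly the prunings of u (2); only
-- one-tree monomials s have a grafting isomorphic to a tree t, n(s;t) of them (1b); and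
-- by induction on the forest Δ ∘ N = (N ⊗ id + id ⊗ N + (• ·) ⊗ deg) ∘ Δ, the last term
-- counting a leaf grafted onto the trunk and cut off again, which transposes to (1c).

module Multiplicity where
  open import Data.Bool using (true; false; if_then_else_)
  open import Data.Nat using (zero; suc; _+_; _*_; _<_; s≤s)
  open import Data.Nat.Properties using (+-identityʳ; suc-injective)
  open import Data.Nat.ListAction using (sum)
  open import Data.List using (List; []; _∷_; _++_; map; concatMap; filter; applyUpTo)
  open import Data.List.Properties using (∷-injectiveˡ; ∷-injectiveʳ; ≡-dec)
  open import Data.List.Relation.Unary.All as All using (All; []; _∷_)
  import Data.List.Relation.Unary.All.Properties as Allₚ
  open import Level using (0ℓ)
  open import Relation.Binary.Definitions using (DecidableEquality)
  open import Relation.Binary.PropositionalEquality using (_≡_; _≢_; refl; cong; cong₂; trans)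
  open import Relation.Nullary.Decidable using (yes; no; does; dec-true; dec-false)
  open import Relation.Nullary.Negation using (contradiction)
  open import Relation.Unary using (Pred; Decidable)
  open import Function using (_∘_)

  mult : {A : Set} → DecidableEquality A → A → List A → ℕ
  mult _≟_ x [] = 0
  mult _≟_ x (y ∷ ys) = if does (y ≟ x) then suc (mult _≟_ x ys) else mult _≟_ x ys

  mult-map : ∀ {A B : Set} (_≟ᴬ_ : DecidableEquality A) (_≟ᴮ_ : DecidableEquality B) {f : A → B} →
             (∀ {x y} → f x ≡ f y → x ≡ y) → ∀ x xs → mult _≟ᴮ_ (f x) (map f xs) ≡ mult _≟ᴬ_ x xs
  mult-map _≟ᴬ_ _≟ᴮ_ f-inj x [] = refl
  mult-map _≟ᴬ_ _≟ᴮ_ {f} f-inj x (y ∷ ys) with y ≟ᴬ x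
  ... | yes refl rewrite dec-true (f y ≟ᴮ f y) refl = cong suc (mult-map _≟ᴬ_ _≟ᴮ_ f-inj x ys)
  ... | no y≢x rewrite dec-false (f y ≟ᴮ f x) (y≢x ∘ f-inj) = mult-map _≟ᴬ_ _≟ᴮ_ f-inj x ys

  module _ {A : Set} (_≟_ : DecidableEquality A) where

    mult-++ : ∀ x xs ys → mult _≟_ x (xs ++ ys) ≡ mult _≟_ x xs + mult _≟_ x ys
    mult-++ x [] ys = refl
    mult-++ x (y ∷ xs) ys with does (y ≟ x)
    ... | true = cong suc (mult-++ x xs ys)
    ... | false = mult-++ x xs ys

    mult-concatMap : ∀ {B : Set} x (f : B → List A) ys → mult _≟_ x (concatMap f ys) ≡ sum (map (mult _≟_ x ∘ f) ys)
    mult-concatMap x f [] = refl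
    mult-concatMap x f (y ∷ ys) = trans (mult-++ x (f y) (concatMap f ys)) (cong (mult _≟_ x (f y) +_) (mult-concatMap x f ys))

    mult-absent : ∀ {x xs} → All (_≢ x) xs → mult _≟_ x xs ≡ 0
    mult-absent [] = refl
    mult-absent {x} {y ∷ _} (y≢x ∷ ys≢x) rewrite dec-false (y ≟ x) y≢x = mult-absent ys≢x

    mult-filter : ∀ {P : Pred A 0ℓ} (P? : Decidable P) {x} → P x → ∀ xs → mult _≟_ x (filter P? xs) ≡ mult _≟_ x xs
    mult-filter P? px [] = refl
    mult-filter P? {x} px (y ∷ ys) with P? y
    ... | yes _ with y ≟ x
    ...   | yes _ = cong suc (mult-filter P? px ys)
    ...   | no _ = mult-filter P? px ys
    mult-filter P? {x} px (y ∷ ys) | no ¬py with y ≟ x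
    ...   | yes refl = contradiction px ¬py
    ...   | no _ = mult-filter P? px ys

  module _ {A : Set} (_≟_ : DecidableEquality A) where

    mult-∷-cartesian : ∀ c cs (ts : List A) (Ls : List (List A)) →
                       mult (≡-dec _≟_) (c ∷ cs) (concatMap (λ t → map (t ∷_) Ls) ts)
                         ≡ mult _≟_ c ts * mult (≡-dec _≟_) cs Ls
    mult-∷-cartesian c cs [] Ls = refl
    mult-∷-cartesian c cs (t ∷ ts) Ls
      rewrite mult-++ (≡-dec _≟_) (c ∷ cs) (map (t ∷_) Ls) (concatMap (λ t → map (t ∷_) Ls) ts)
            | mult-∷-cartesian c cs ts Ls
      with t ≟ c
    ... | yes refl = cong (_+ mult _≟_ c ts * mult (≡-dec _≟_) cs Ls) (mult-map (≡-dec _≟_) (≡-dec _≟_) ∷-injectiveʳ cs Ls)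
    ... | no t≢c = cong (_+ mult _≟_ c ts * mult (≡-dec _≟_) cs Ls)
                        (mult-absent (≡-dec _≟_) (Allₚ.map⁺ (All.universal (λ _ eq → t≢c (∷-injectiveˡ eq)) Ls)))

  sum-applyUpTo-zero : ∀ (h : ℕ → ℕ) n → (∀ k → h k ≡ 0) → sum (applyUpTo h n) ≡ 0
  sum-applyUpTo-zero h zero vanish = refl
  sum-applyUpTo-zero h (suc n) vanish = cong₂ _+_ (vanish 0) (sum-applyUpTo-zero (h ∘ suc) n (vanish ∘ suc))

  sum-applyUpTo-single : ∀ (h : ℕ → ℕ) {n j} → j < n → (∀ k → k ≢ j → h k ≡ 0) → sum (applyUpTo h n) ≡ h j
  sum-applyUpTo-single h {suc n} {zero} _ vanish =
    trans (cong (h 0 +_) (sum-applyUpTo-zero (h ∘ suc) n (λ k → vanish (suc k) λ ()))) (+-identityʳ (h 0))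
  sum-applyUpTo-single h {suc n} {suc j} (s≤s j<n) vanish =
    cong₂ _+_ (vanish 0 λ ()) (sum-applyUpTo-single (h ∘ suc) j<n (λ k k≢j → vanish (suc k) (k≢j ∘ suc-injective)))

module RootedTrees where
  open Multiplicity
  open import Level using (0ℓ)
  open import Data.Bool using (Bool; true; false; T; if_then_else_)
  import Data.Bool as Bool
  open import Data.Unit using (tt)
  open import Data.Nat using (zero; suc; _+_; _*_; _⊔_; _<_; z≤n; s≤s)
  open import Data.Nat.Properties
    using (+-comm; +-suc; suc-injective; *-suc; *-distribˡ-+; ⊔-lub; m≤m+n; +-mono-≤; ≤-trans; <⇒≤; *-monoˡ-≤;
           m+[n∸m]≡n; m+n∸m≡n; m≤m⊔n; m≤n⊔m)
  open import Data.Nat.ListAction using (sum)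
  import Data.Nat.ListAction.Properties as ℕ
  open import Data.List using (List; []; _∷_; _++_; [_]; map; length; concatMap; filter; applyUpTo; upTo)
  open import Data.List.Properties using (∷-injectiveʳ; ++-assoc; ++-identityʳ; ≡-dec; length-map; map-++; map-cong; map-applyUpTo)
  open import Data.List.Relation.Binary.Permutation.Propositional using (_↭_; ↭-sym; ↭-trans; ↭⇒↭ₛ)
  import Data.List.Relation.Binary.Permutation.Propositional.Properties as ↭
  open ↭ using (All-resp-↭)
  open import Data.List.Relation.Binary.Pointwise using (Pointwise-≡⇒≡)
  open import Data.List.Relation.Unary.All as All using (All; []; _∷_)
  import Data.List.Relation.Unary.All.Properties as Allₚ
  import Data.List.Sort.InsertionSort.Base
  import Data.List.Sort.InsertionSort.Properties
  open import Data.List.Relation.Unary.Sorted.TotalOrder.Properties using (↗↭↗⇒≋)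
  open import Data.Product using (proj₁)
  open import Data.Sum using (_⊎_; inj₁; inj₂)
  open import Relation.Binary.Bundles using (DecTotalOrder)
  open import Relation.Binary.Definitions using (DecidableEquality)
  open import Relation.Binary.PropositionalEquality
    using (_≡_; _≢_; refl; sym; trans; cong; cong₂; subst; subst₂; isEquivalence; module ≡-Reasoning)
  open import Relation.Nullary.Decidable using (Dec; does; map′; T?; dec-true; dec-false)
  open import Relation.Nullary.Negation using (contradiction)
  open import Function using (id)

  leqB-refl : ∀ xs → T (leqB xs xs)
  leqB-refl [] = tt
  leqB-refl (true ∷ xs) = leqB-refl xs
  leqB-refl (false ∷ xs) = leqB-refl xs

  leqB-trans : ∀ xs ys zs → T (leqB xs ys) → T (leqB ys zs) → T (leqB xs zs)
  leqB-trans [] _ _ _ _ = tt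
  leqB-trans (_ ∷ _) (_ ∷ _) [] _ ()
  leqB-trans (false ∷ xs) (false ∷ ys) (false ∷ zs) p q = leqB-trans xs ys zs p q
  leqB-trans (false ∷ xs) (false ∷ ys) (true ∷ zs) p q = tt
  leqB-trans (false ∷ xs) (true ∷ ys) (true ∷ zs) p q = tt
  leqB-trans (true ∷ xs) (true ∷ ys) (true ∷ zs) p q = leqB-trans xs ys zs p q

  leqB-antisym : ∀ xs ys → T (leqB xs ys) → T (leqB ys xs) → xs ≡ ys
  leqB-antisym [] [] _ _ = refl
  leqB-antisym (false ∷ xs) (false ∷ ys) p q = cong (false ∷_) (leqB-antisym xs ys p q)
  leqB-antisym (true ∷ xs) (true ∷ ys) p q = cong (true ∷_) (leqB-antisym xs ys p q)

  leqB-total : ∀ xs ys → T (leqB xs ys) ⊎ T (leqB ys xs)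
  leqB-total [] ys = inj₁ tt
  leqB-total (x ∷ xs) [] = inj₂ tt
  leqB-total (false ∷ xs) (false ∷ ys) = leqB-total xs ys
  leqB-total (false ∷ xs) (true ∷ ys) = inj₁ tt
  leqB-total (true ∷ xs) (false ∷ ys) = inj₂ tt
  leqB-total (true ∷ xs) (true ∷ ys) = leqB-total xs ys

  mutual
    code-++-injective : ∀ s t {r r'} → code s ++ r ≡ code t ++ r' → s ≡ t × r ≡ r'
    code-++-injective (node ss) (node ts) {r} {r'} eq
      with codeF-++-injective ss ts (begin
             codeF ss ++ false ∷ r       ≡⟨ ++-assoc (codeF ss) [ false ] r ⟨
             (codeF ss ++ [ false ]) ++ r ≡⟨ ∷-injectiveʳ eq ⟩
             (codeF ts ++ [ false ]) ++ r' ≡⟨ ++-assoc (codeF ts) [ false ] r' ⟩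
             codeF ts ++ false ∷ r'      ∎)
      where open ≡-Reasoning
    ... | refl , r≡r' = refl , r≡r'

    codeF-++-injective : ∀ ss ts {r r'} → codeF ss ++ false ∷ r ≡ codeF ts ++ false ∷ r' → ss ≡ ts × r ≡ r'
    codeF-++-injective [] [] eq = refl , ∷-injectiveʳ eq
    codeF-++-injective (s ∷ ss) (t ∷ ts) {r} {r'} eq
      with code-++-injective s t (begin
             code s ++ codeF ss ++ false ∷ r   ≡⟨ ++-assoc (code s) (codeF ss) (false ∷ r) ⟨
             (code s ++ codeF ss) ++ false ∷ r ≡⟨ eq ⟩
             (code t ++ codeF ts) ++ false ∷ r' ≡⟨ ++-assoc (code t) (codeF ts) (false ∷ r') ⟩
             code t ++ codeF ts ++ false ∷ r'  ∎)
      where open ≡-Reasoning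
    ... | refl , eq′ with codeF-++-injective ss ts eq′
    ...   | refl , r≡r' = refl , r≡r'
    codeF-++-injective [] (node _ ∷ _) ()
    codeF-++-injective (node _ ∷ _) [] ()

  code-injective : ∀ {s t} → code s ≡ code t → s ≡ t
  code-injective {s} {t} eq =
    proj₁ (code-++-injective s t (trans (++-identityʳ (code s)) (trans eq (sym (++-identityʳ (code t))))))

  codeF-injective : ∀ {ss ts} → codeF ss ≡ codeF ts → ss ≡ ts
  codeF-injective {ss} {ts} eq = proj₁ (codeF-++-injective ss ts (cong (_++ [ false ]) eq))

  eqB-sound : ∀ xs ys → eqB xs ys ≡ true → xs ≡ ys
  eqB-sound [] [] _ = refl
  eqB-sound (true ∷ xs) (true ∷ ys) p = cong (true ∷_) (eqB-sound xs ys p)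
  eqB-sound (false ∷ xs) (false ∷ ys) p = cong (false ∷_) (eqB-sound xs ys p)

  eqB-refl : ∀ xs → eqB xs xs ≡ true
  eqB-refl [] = refl
  eqB-refl (true ∷ xs) = eqB-refl xs
  eqB-refl (false ∷ xs) = eqB-refl xs

  infix 4 _≟ᵀ_ _≟ᶠ_

  -- opaque, so that `with s ≟ᵀ t` also abstracts the occurrences hidden inside `mult`
  opaque
    _≟ᵀ_ : DecidableEquality Tree
    s ≟ᵀ t = map′ code-injective (cong code) (≡-dec Bool._≟_ (code s) (code t))

  _≟ᶠ_ : DecidableEquality Forest
  _≟ᶠ_ = ≡-dec _≟ᵀ_

  codeOrder : DecTotalOrder 0ℓ 0ℓ 0ℓ
  codeOrder = record
    { Carrier = Tree
    ; _≈_ = _≡_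
    ; _≤_ = λ s t → T (leqB (code s) (code t))
    ; isDecTotalOrder = record
      { isTotalOrder = record
        { isPartialOrder = record
          { isPreorder = record
            { isEquivalence = isEquivalence
            ; reflexive = λ { {s} refl → leqB-refl (code s) }
            ; trans = λ {r} {s} {t} → leqB-trans (code r) (code s) (code t)
            }
          ; antisym = λ {s} {t} p q → code-injective (leqB-antisym (code s) (code t) p q)
          }
        ; total = λ s t → leqB-total (code s) (code t)
        }
      ; _≟_ = _≟ᵀ_
      ; _≤?_ = λ s t → T? (leqB (code s) (code t))
      }
    }

  module CodeSort = Data.List.Sort.InsertionSort.Base codeOrder
  module CodeSortProperties = Data.List.Sort.InsertionSort.Properties codeOrder

  insertT-≡-insert : ∀ t ts → insertT t ts ≡ CodeSort.insert t ts
  insertT-≡-insert t [] = refl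
  insertT-≡-insert t (s ∷ ss) with leqB (code t) (code s)
  ... | true = refl
  ... | false = cong (s ∷_) (insertT-≡-insert t ss)

  sortT-≡-sort : ∀ ts → sortT ts ≡ CodeSort.sort ts
  sortT-≡-sort [] = refl
  sortT-≡-sort (t ∷ ts) = trans (cong (insertT t) (sortT-≡-sort ts)) (insertT-≡-insert t (CodeSort.sort ts))

  sortT-↭ : ∀ ts → sortT ts ↭ ts
  sortT-↭ ts rewrite sortT-≡-sort ts = CodeSortProperties.sort-↭ ts

  sortT-cong-↭ : ∀ {ss ts} → ss ↭ ts → sortT ss ≡ sortT ts
  sortT-cong-↭ {ss} {ts} ss↭ts rewrite sortT-≡-sort ss | sortT-≡-sort ts =
    Pointwise-≡⇒≡ (↗↭↗⇒≋ (DecTotalOrder.totalOrder codeOrder)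
      (CodeSortProperties.sort-↗ ss) (CodeSortProperties.sort-↗ ts)
      (↭⇒↭ₛ (↭-trans (CodeSortProperties.sort-↭ ss) (↭-trans ss↭ts (↭-sym (CodeSortProperties.sort-↭ ts))))))

  Canonical : Tree → Set
  Canonical t = canon t ≡ t

  canonL-≡-map : ∀ ts → canonL ts ≡ map canon ts
  canonL-≡-map [] = refl
  canonL-≡-map (t ∷ ts) = cong (canon t ∷_) (canonL-≡-map ts)

  canonL-id : ∀ {ts} → All Canonical ts → canonL ts ≡ ts
  canonL-id [] = refl
  canonL-id (eq ∷ eqs) = cong₂ _∷_ eq (canonL-id eqs)

  sortT-canonical : ∀ {ts} → All Canonical ts → All Canonical (sortT ts)
  sortT-canonical {ts} = All-resp-↭ (↭-sym (sortT-↭ ts))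

  mutual
    canon-idem : ∀ t → canon (canon t) ≡ canon t
    canon-idem (node ts) = cong node (canonF-idem ts)

    canonF-idem : ∀ ts → canonF (canonF ts) ≡ canonF ts
    canonF-idem ts =
      trans (cong sortT (canonL-id (sortT-canonical (canonL-canonical ts))))
            (sortT-cong-↭ (sortT-↭ (canonL ts)))

    canonL-canonical : ∀ ts → All Canonical (canonL ts)
    canonL-canonical [] = []
    canonL-canonical (t ∷ ts) = canon-idem t ∷ canonL-canonical ts

  canonF-canonical : ∀ ts → All Canonical (canonF ts)
  canonF-canonical ts = sortT-canonical (canonL-canonical ts)

  infix 4 _≃_
  record _≃_ (ss ts : Forest) : Set where
    constructor iso
    field same-canonF : canonF ss ≡ canonF ts

  ≃-refl : ∀ {ts} → ts ≃ ts
  ≃-refl = iso refl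

  ≃-sym : ∀ {ss ts} → ss ≃ ts → ts ≃ ss
  ≃-sym (iso eq) = iso (sym eq)

  canonF-≃ : ∀ ts → canonF ts ≃ ts
  canonF-≃ ts = iso (canonF-idem ts)

  canonL-≃ : ∀ ts → canonL ts ≃ ts
  canonL-≃ ts = iso (cong sortT (canonL-id (canonL-canonical ts)))

  ↭⇒≃ : ∀ {ss ts} → ss ↭ ts → ss ≃ ts
  ↭⇒≃ {ss} {ts} ss↭ts =
    iso (sortT-cong-↭ (subst₂ _↭_ (sym (canonL-≡-map ss)) (sym (canonL-≡-map ts)) (↭.map⁺ canon ss↭ts)))

  canonF-++ : ∀ ss ts → canonF (ss ++ ts) ≡ canonF (canonF ss ++ canonF ts)
  canonF-++ ss ts = begin
    sortT (canonL (ss ++ ts))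
      ≡⟨ cong sortT (canonL-++ ss) ⟩
    sortT (canonL ss ++ canonL ts)
      ≡⟨ sortT-cong-↭ (↭.++⁺ (↭-sym (sortT-↭ (canonL ss))) (↭-sym (sortT-↭ (canonL ts)))) ⟩
    sortT (canonF ss ++ canonF ts)
      ≡⟨ cong sortT (canonL-id (Allₚ.++⁺ (canonF-canonical ss) (canonF-canonical ts))) ⟨
    sortT (canonL (canonF ss ++ canonF ts)) ∎
    where
    open ≡-Reasoning
    canonL-++ : ∀ ss {ts} → canonL (ss ++ ts) ≡ canonL ss ++ canonL ts
    canonL-++ [] = refl
    canonL-++ (s ∷ ss) = cong (canon s ∷_) (canonL-++ ss)

  ++-cong-≃ : ∀ {ss ss′ ts ts′} → ss ≃ ss′ → ts ≃ ts′ → ss ++ ts ≃ ss′ ++ ts′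
  ++-cong-≃ {ss} {ss′} {ts} {ts′} (iso eq) (iso eq′) =
    iso (trans (canonF-++ ss ts) (trans (cong₂ (λ xs ys → canonF (xs ++ ys)) eq eq′) (sym (canonF-++ ss′ ts′))))

  ∷-cong-≃ : ∀ {s s′ ts ts′} → canon s ≡ canon s′ → ts ≃ ts′ → s ∷ ts ≃ s′ ∷ ts′
  ∷-cong-≃ eq = ++-cong-≃ (iso (cong [_] eq))

  node-cong-≃ : ∀ {ss ts} → ss ≃ ts → [ node ss ] ≃ [ node ts ]
  node-cong-≃ (iso eq) = iso (cong (λ us → [ node us ]) eq)

  sizeF-≡-sum : ∀ ts → sizeF ts ≡ sum (map size ts)
  sizeF-≡-sum [] = refl
  sizeF-≡-sum (t ∷ ts) = cong (size t +_) (sizeF-≡-sum ts)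

  sizeF-++ : ∀ ss ts → sizeF (ss ++ ts) ≡ sizeF ss + sizeF ts
  sizeF-++ ss ts = begin
    sizeF (ss ++ ts)                       ≡⟨ sizeF-≡-sum (ss ++ ts) ⟩
    sum (map size (ss ++ ts))              ≡⟨ cong sum (map-++ size ss ts) ⟩
    sum (map size ss ++ map size ts)       ≡⟨ ℕ.sum-++ (map size ss) (map size ts) ⟩
    sum (map size ss) + sum (map size ts)  ≡⟨ cong₂ _+_ (sizeF-≡-sum ss) (sizeF-≡-sum ts) ⟨
    sizeF ss + sizeF ts                    ∎
    where open ≡-Reasoning

  sizeF-↭ : ∀ {ss ts} → ss ↭ ts → sizeF ss ≡ sizeF ts
  sizeF-↭ {ss} {ts} ss↭ts rewrite sizeF-≡-sum ss | sizeF-≡-sum ts = ℕ.sum-↭ (↭.map⁺ size ss↭ts)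

  mutual
    size-canon : ∀ t → size (canon t) ≡ size t
    size-canon (node ts) = cong suc (sizeF-canonF ts)

    sizeF-canonF : ∀ ts → sizeF (canonF ts) ≡ sizeF ts
    sizeF-canonF ts = trans (sizeF-↭ (sortT-↭ (canonL ts))) (sizeF-canonL ts)

    sizeF-canonL : ∀ ts → sizeF (canonL ts) ≡ sizeF ts
    sizeF-canonL [] = refl
    sizeF-canonL (t ∷ ts) = cong₂ _+_ (size-canon t) (sizeF-canonL ts)

  length-canonF : ∀ ts → length (canonF ts) ≡ length ts
  length-canonF ts = begin
    length (sortT (canonL ts))  ≡⟨ ↭.↭-length (sortT-↭ (canonL ts)) ⟩
    length (canonL ts)          ≡⟨ cong length (canonL-≡-map ts) ⟩
    length (map canon ts)       ≡⟨ length-map canon ts ⟩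
    length ts                   ∎
    where open ≡-Reasoning

  ≅ᵇ-sound : ∀ {s t} → s ≅ᵇ t ≡ true → canon s ≡ canon t
  ≅ᵇ-sound eq = code-injective (eqB-sound _ _ eq)

  ≅Fᵇ-sound : ∀ {ss ts} → ss ≅Fᵇ ts ≡ true → canonF ss ≡ canonF ts
  ≅Fᵇ-sound eq = codeF-injective (eqB-sound _ _ eq)

  []≅Fᵇ[-] : ∀ t → [] ≅Fᵇ [ t ] ≡ false
  []≅Fᵇ[-] (node _) = refl

  [-]≅Fᵇ[-] : ∀ s t → [ s ] ≅Fᵇ [ t ] ≡ s ≅ᵇ t
  [-]≅Fᵇ[-] s t rewrite ++-identityʳ (code (canon s)) | ++-identityʳ (code (canon t)) = refl

  ≅ᵇ-canon : ∀ s → s ≅ᵇ canon s ≡ true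
  ≅ᵇ-canon s = trans (cong (λ u → eqB (code (canon s)) (code u)) (canon-idem s)) (eqB-refl (code (canon s)))

  ≅ᵇ-canonical : ∀ s {t} → Canonical t → s ≅ᵇ t ≡ does (t ≟ᵀ canon s)
  ≅ᵇ-canonical s {t} t-canonical with s ≅ᵇ t in eq
  ... | true = sym (dec-true (t ≟ᵀ canon s) (trans (sym t-canonical) (sym (≅ᵇ-sound eq))))
  ... | false = sym (dec-false (t ≟ᵀ canon s) λ { refl → contradiction (trans (sym (≅ᵇ-canon s)) eq) λ () })

  ≅ᵇ-size : ∀ {s t} → s ≅ᵇ t ≡ true → size s ≡ size t
  ≅ᵇ-size {s} {t} eq = trans (sym (size-canon s)) (trans (cong size (≅ᵇ-sound eq)) (size-canon t))

  ≅Fᵇ-length : ∀ {ss ts} → ss ≅Fᵇ ts ≡ true → length ss ≡ length ts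
  ≅Fᵇ-length {ss} {ts} eq = trans (sym (length-canonF ss)) (trans (cong length (≅Fᵇ-sound {ss} {ts} eq)) (length-canonF ts))

  ≅ᵇ-false : ∀ {s t} → size s ≢ size t → s ≅ᵇ t ≡ false
  ≅ᵇ-false {s} {t} size≢ with s ≅ᵇ t in eq
  ... | true = contradiction (≅ᵇ-size eq) size≢
  ... | false = refl

  mutual
    fuelT : Tree → ℕ
    fuelT (node ts) = suc (fuelF ts)

    fuelF : Forest → ℕ
    fuelF [] = 0
    fuelF (t ∷ ts) = suc (fuelT t ⊔ fuelF ts)

  mutual
    fuelT<2*size : ∀ t → fuelT t < 2 * size t
    fuelT<2*size (node ts) = subst (suc (fuelT (node ts)) ≤_) (sym (*-suc 2 (sizeF ts))) (s≤s (s≤s (fuelF≤2*sizeF ts)))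

    fuelF≤2*sizeF : ∀ ts → fuelF ts ≤ 2 * sizeF ts
    fuelF≤2*sizeF [] = z≤n
    fuelF≤2*sizeF (node ss ∷ ts) = subst (fuelF (node ss ∷ ts) ≤_) (sym (*-distribˡ-+ 2 (size (node ss)) (sizeF ts)))
      (⊔-lub (≤-trans (fuelT<2*size (node ss)) (m≤m+n _ _))
             (+-mono-≤ {1} (subst (1 ≤_) (sym (*-suc 2 (sizeF ss))) (s≤s z≤n)) (fuelF≤2*sizeF ts)))

  fuelT≤3*size : ∀ t → fuelT t ≤ 3 * size t
  fuelT≤3*size t = ≤-trans (<⇒≤ (fuelT<2*size t)) (*-monoˡ-≤ (size t) (s≤s (s≤s (z≤n {1}))))

  node-injective : ∀ {ss ts} → node ss ≡ node ts → ss ≡ ts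
  node-injective refl = refl

  mutual
    planarTrees-size : ∀ f n → All (λ t → size t ≡ n) (planarTrees f n)
    planarTrees-size zero n = []
    planarTrees-size (suc f) zero = []
    planarTrees-size (suc f) (suc m) = Allₚ.map⁺ (All.map (cong suc) (planarForests-size f m))

    planarForests-size : ∀ f n → All (λ ts → sizeF ts ≡ n) (planarForests f n)
    planarForests-size f zero = refl ∷ []
    planarForests-size zero (suc m) = []
    planarForests-size (suc f) (suc m) =
      Allₚ.concat⁺ (Allₚ.map⁺ (Allₚ.applyUpTo⁺₁ id (suc m) λ {k} k<1+m →
        Allₚ.concat⁺ (Allₚ.map⁺ (All.map (λ {t} size-t →
          Allₚ.map⁺ (All.map (λ size-ts → trans (cong₂ _+_ size-t size-ts) (m+[n∸m]≡n k<1+m))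
                             (planarForests-size f (m ∸ k))))
          (planarTrees-size f (suc k))))))

  mutual
    planarTrees-mult : ∀ t {f} → fuelT t ≤ f → mult _≟ᵀ_ t (planarTrees f (size t)) ≡ 1
    planarTrees-mult (node ts) {suc f} (s≤s fuel≤f) =
      trans (mult-map _≟ᶠ_ _≟ᵀ_ node-injective ts (planarForests f (sizeF ts))) (planarForests-mult ts fuel≤f)

    planarForests-mult : ∀ ts {f} → fuelF ts ≤ f → mult _≟ᶠ_ ts (planarForests f (sizeF ts)) ≡ 1
    planarForests-mult [] _ = refl
    planarForests-mult (t@(node ss) ∷ ts) {suc f} (s≤s fuel≤f) = begin
      mult _≟ᶠ_ (t ∷ ts) (planarForests (suc f) (suc m))
        ≡⟨ mult-concatMap _≟ᶠ_ (t ∷ ts) forests (upTo (suc m)) ⟩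
      sum (map (λ k → mult _≟ᶠ_ (t ∷ ts) (forests k)) (upTo (suc m)))
        ≡⟨ cong sum (map-cong (λ k → mult-∷-cartesian _≟ᵀ_ t ts (planarTrees f (suc k)) (planarForests f (m ∸ k)))
                              (upTo (suc m))) ⟩
      sum (map h (upTo (suc m)))
        ≡⟨ cong sum (map-applyUpTo id h (suc m)) ⟩
      sum (applyUpTo h (suc m))
        ≡⟨ sum-applyUpTo-single h (s≤s (m≤m+n (sizeF ss) (sizeF ts))) other-sizes-vanish ⟩
      h (sizeF ss)
        ≡⟨ cong₂ _*_ (planarTrees-mult t (≤-trans (m≤m⊔n (fuelT t) (fuelF ts)) fuel≤f))
                     (trans (cong (λ n → mult _≟ᶠ_ ts (planarForests f n)) (m+n∸m≡n (sizeF ss) (sizeF ts)))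
                            (planarForests-mult ts (≤-trans (m≤n⊔m (fuelT t) (fuelF ts)) fuel≤f))) ⟩
      1 ∎
      where
      open ≡-Reasoning
      m = sizeF ss + sizeF ts
      forests : ℕ → List Forest
      forests k = concatMap (λ t′ → map (t′ ∷_) (planarForests f (m ∸ k))) (planarTrees f (suc k))
      h : ℕ → ℕ
      h k = mult _≟ᵀ_ t (planarTrees f (suc k)) * mult _≟ᶠ_ ts (planarForests f (m ∸ k))
      other-sizes-vanish : ∀ k → k ≢ sizeF ss → h k ≡ 0
      other-sizes-vanish k k≢ = cong (_* mult _≟ᶠ_ ts (planarForests f (m ∸ k))) (mult-absent _≟ᵀ_
        (All.map (λ size≡ t≡ → k≢ (suc-injective (trans (sym size≡) (cong size t≡)))) (planarTrees-size f (suc k))))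

  hasCanonicalCode? : (t : Tree) → Dec (eqB (code t) (code (canon t)) ≡ true)
  hasCanonicalCode? t = eqB (code t) (code (canon t)) Bool.≟ true

  treesOfSize-canonical : ∀ n → All Canonical (treesOfSize n)
  treesOfSize-canonical n =
    All.map (λ eq → sym (code-injective (eqB-sound _ _ eq))) (Allₚ.all-filter hasCanonicalCode? (planarTrees (3 * n) n))

  treesOfSize-size : ∀ n → All (λ t → size t ≡ n) (treesOfSize n)
  treesOfSize-size n = Allₚ.filter⁺ hasCanonicalCode? (planarTrees-size (3 * n) n)

  treesOfSize-mult : ∀ s → mult _≟ᵀ_ (canon s) (treesOfSize (size s)) ≡ 1
  treesOfSize-mult s = begin
    mult _≟ᵀ_ (canon s) (treesOfSize (size s))
      ≡⟨ mult-filter _≟ᵀ_ hasCanonicalCode? (≅ᵇ-canon s) (planarTrees (3 * size s) (size s)) ⟩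
    mult _≟ᵀ_ (canon s) (planarTrees (3 * size s) (size s))
      ≡⟨ cong (λ n → mult _≟ᵀ_ (canon s) (planarTrees (3 * n) n)) (size-canon s) ⟨
    mult _≟ᵀ_ (canon s) (planarTrees (3 * size (canon s)) (size (canon s)))
      ≡⟨ planarTrees-mult (canon s) (fuelT≤3*size (canon s)) ⟩
    1 ∎
    where open ≡-Reasoning

  mutual
    graftings-size : ∀ t → All (λ s → size s ≡ suc (size t)) (graftings t)
    graftings-size (node ts) = cong suc (trans (sizeF-++ ts [ • ]) (+-comm (sizeF ts) 1))
                             ∷ Allₚ.map⁺ (All.map (cong suc) (graftingsF-size ts))

    graftingsF-size : ∀ ts → All (λ g → sizeF g ≡ suc (sizeF ts)) (graftingsF ts)
    graftingsF-size [] = []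
    graftingsF-size (t ∷ ts) =
      Allₚ.++⁺ (Allₚ.map⁺ (All.map (cong (_+ sizeF ts)) (graftings-size t)))
               (Allₚ.map⁺ (All.map (λ eq → trans (cong (size t +_) eq) (+-suc (size t) (sizeF ts))) (graftingsF-size ts)))

  graftingsF-length : ∀ ts → All (λ g → length g ≡ length ts) (graftingsF ts)
  graftingsF-length [] = []
  graftingsF-length (t ∷ ts) =
    Allₚ.++⁺ (Allₚ.map⁺ (All.universal (λ _ → refl) (graftings t))) (Allₚ.map⁺ (All.map (cong suc) (graftingsF-length ts)))

  mutual
    prunings-size : ∀ t → All (λ s → suc (size s) ≡ size t) (prunings t)
    prunings-size (node ts) = Allₚ.map⁺ (All.map (cong suc) (pruningsF-size ts))

    pruningsF-size : ∀ ts → All (λ g → suc (sizeF g) ≡ sizeF ts) (pruningsF ts)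
    pruningsF-size [] = []
    pruningsF-size (t ∷ ts) =
      Allₚ.++⁺ (terminal t)
        (Allₚ.++⁺ (Allₚ.map⁺ (All.map (cong (_+ sizeF ts)) (prunings-size t)))
                  (Allₚ.map⁺ (All.map (λ eq → trans (sym (+-suc (size t) _)) (cong (size t +_) eq)) (pruningsF-size ts))))
      where
      terminal : ∀ t → All (λ g → suc (sizeF g) ≡ size t + sizeF ts) (if isTerminal t then [ ts ] else [])
      terminal (node []) = refl ∷ []
      terminal (node (_ ∷ _)) = []

module ListSum {c ℓ} (R : CommutativeSemiring c ℓ) where
  open import Data.Product using (uncurry)
  open import Data.List using (List; []; _∷_; _++_; map; concatMap)
  open import Data.List.Relation.Unary.All as All using (All; []; _∷_)
  open import Function using (_∘_)
  open import Level using (0ℓ)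
  open import Relation.Binary.PropositionalEquality as ≡ using (_≡_)
  open import Relation.Unary using (Pred)
  open CommutativeSemiring R
  open import Algebra.Properties.CommutativeSemigroup +-commutativeSemigroup using (interchange)
  open import Relation.Binary.Reasoning.Setoid setoid

  ∑ : {A : Set} → List A → (A → Carrier) → Carrier
  ∑ [] f = 0#
  ∑ (x ∷ xs) f = f x + ∑ xs f

  ∑₂ : {A B : Set} → List (A × B) → (A → B → Carrier) → Carrier
  ∑₂ xs f = ∑ xs (uncurry f)

  private variable A B : Set

  ∑-cong : ∀ xs {f g : A → Carrier} → (∀ x → f x ≈ g x) → ∑ xs f ≈ ∑ xs g
  ∑-cong [] f≈g = refl
  ∑-cong (x ∷ xs) f≈g = +-cong (f≈g x) (∑-cong xs f≈g)

  ∑-cong-All : ∀ {P : Pred A 0ℓ} {xs} {f g : A → Carrier} → All P xs → (∀ {x} → P x → f x ≈ g x) →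
               ∑ xs f ≈ ∑ xs g
  ∑-cong-All [] f≈g = refl
  ∑-cong-All (px ∷ pxs) f≈g = +-cong (f≈g px) (∑-cong-All pxs f≈g)

  ∑-zero : ∀ {xs} {f : A → Carrier} → All (λ x → f x ≈ 0#) xs → ∑ xs f ≈ 0#
  ∑-zero [] = refl
  ∑-zero (fx≈0 ∷ fxs≈0) = trans (+-cong fx≈0 (∑-zero fxs≈0)) (+-identityˡ 0#)

  ∑-++ : ∀ xs ys (f : A → Carrier) → ∑ (xs ++ ys) f ≈ ∑ xs f + ∑ ys f
  ∑-++ [] ys f = sym (+-identityˡ _)
  ∑-++ (x ∷ xs) ys f = trans (+-congˡ (∑-++ xs ys f)) (sym (+-assoc _ _ _))

  ∑-map : ∀ (g : A → B) xs (f : B → Carrier) → ∑ (map g xs) f ≡ ∑ xs (f ∘ g)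
  ∑-map g [] f = ≡.refl
  ∑-map g (x ∷ xs) f = ≡.cong (f (g x) +_) (∑-map g xs f)

  ∑-concatMap : ∀ (g : A → List B) xs (f : B → Carrier) → ∑ (concatMap g xs) f ≈ ∑ xs (λ x → ∑ (g x) f)
  ∑-concatMap g [] f = refl
  ∑-concatMap g (x ∷ xs) f = trans (∑-++ (g x) (concatMap g xs) f) (+-congˡ (∑-concatMap g xs f))

  ∑-+ : ∀ xs (f g : A → Carrier) → ∑ xs (λ x → f x + g x) ≈ ∑ xs f + ∑ xs g
  ∑-+ [] f g = sym (+-identityˡ 0#)
  ∑-+ (x ∷ xs) f g = trans (+-congˡ (∑-+ xs f g)) (interchange (f x) (g x) (∑ xs f) (∑ xs g))

  ∑-*ˡ : ∀ a xs (f : A → Carrier) → a * ∑ xs f ≈ ∑ xs (λ x → a * f x)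
  ∑-*ˡ a [] f = zeroʳ a
  ∑-*ˡ a (x ∷ xs) f = trans (distribˡ a (f x) (∑ xs f)) (+-congˡ (∑-*ˡ a xs f))

  ∑-*ʳ : ∀ a xs (f : A → Carrier) → ∑ xs f * a ≈ ∑ xs (λ x → f x * a)
  ∑-*ʳ a [] f = zeroˡ a
  ∑-*ʳ a (x ∷ xs) f = trans (distribʳ a (f x) (∑ xs f)) (+-congˡ (∑-*ʳ a xs f))

  ∑-comm : ∀ xs ys (f : A → B → Carrier) → ∑ xs (λ x → ∑ ys (f x)) ≈ ∑ ys (λ y → ∑ xs (λ x → f x y))
  ∑-comm [] ys f = sym (∑-zero (All.universal (λ _ → refl) ys))
  ∑-comm (x ∷ xs) ys f = trans (+-congˡ (∑-comm xs ys f)) (sym (∑-+ ys (f x) (λ y → ∑ xs (λ x → f x y))))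

  ∑-unique : ∀ (s : List A → Carrier) {f : A → Carrier} → s [] ≡ 0# → (∀ x xs → s (x ∷ xs) ≡ f x + s xs) →
             ∀ xs → s xs ≡ ∑ xs f
  ∑-unique s s-[] s-∷ [] = s-[]
  ∑-unique s s-[] s-∷ (x ∷ xs) = ≡.trans (s-∷ x xs) (≡.cong (_ +_) (∑-unique s s-[] s-∷ xs))

  ∑-cong-≡ : ∀ xs {f g : A → Carrier} → (∀ x → f x ≡ g x) → ∑ xs f ≡ ∑ xs g
  ∑-cong-≡ [] f≡g = ≡.refl
  ∑-cong-≡ (x ∷ xs) f≡g = ≡.cong₂ _+_ (f≡g x) (∑-cong-≡ xs f≡g)

module Transposes {c ℓ} (K : CommutativeRing c ℓ) where
  open import Data.Bool using (Bool; true; false; if_then_else_)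
  open import Data.Nat using (zero; suc) renaming (_+_ to _+ℕ_)
  import Data.Nat.Properties as ℕ
  open import Data.List using (List; []; _∷_; _++_; [_]; map; length)
  open import Data.List.Properties using (++-assoc; ++-identityʳ)
  open import Data.List.Relation.Unary.All as All using (All; []; _∷_)
  import Data.List.Relation.Binary.Permutation.Propositional as ↭
  import Data.List.Relation.Binary.Permutation.Propositional.Properties as ↭ₚ
  open ↭ using (_↭_; ↭-sym)
  open import Data.Product using (proj₁; proj₂)
  open import Relation.Binary.PropositionalEquality as ≡ using (_≡_; _≢_)
  open import Relation.Nullary.Decidable using (Dec; does; yes; no)
  open import Relation.Nullary.Negation using (contradiction)
  import Algebra.Properties.CommutativeSemigroup
  open RootedTrees
  open Multiplicity
  open CommutativeRing K
  open Dual K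
  open ListSum commutativeSemiring
  open import Algebra.Properties.CommutativeSemigroup +-commutativeSemigroup using (x∙yz≈y∙xz; interchange)
  module * = Algebra.Properties.CommutativeSemigroup *-commutativeSemigroup
  open import Relation.Binary.Reasoning.Setoid setoid
  open import Algebra.Solver.Ring.NaturalCoefficients.Default commutativeSemiring using (solve; _:=_; _:+_; _:*_)

  natK-+ : ∀ m n → natK K (m +ℕ n) ≈ natK K m + natK K n
  natK-+ zero n = sym (+-identityˡ _)
  natK-+ (suc m) n = trans (+-congˡ (natK-+ m n)) (sym (+-assoc _ _ _))

  natK-suc-* : ∀ n x → natK K (suc n) * x ≈ x + natK K n * x
  natK-suc-* n x = trans (distribʳ x 1# (natK K n)) (+-congʳ (*-identityˡ x))

  natK-1-* : ∀ x → natK K 1 * x ≈ x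
  natK-1-* x = trans (natK-suc-* 0 x) (trans (+-congˡ (zeroˡ x)) (+-identityʳ x))

  ∑-indicator : ∀ (f : Tree → Carrier) t ts →
                ∑ ts (λ s → if does (s ≟ᵀ t) then f s else 0#) ≈ natK K (mult _≟ᵀ_ t ts) * f t
  ∑-indicator f t [] = sym (zeroˡ _)
  ∑-indicator f t (s ∷ ts) with s ≟ᵀ t
  ... | yes ≡.refl = trans (+-congˡ (∑-indicator f t ts)) (sym (natK-suc-* (mult _≟ᵀ_ t ts) (f t)))
  ... | no _ = trans (+-identityˡ _) (∑-indicator f t ts)

  ∑-count : ∀ (p : Tree → Bool) ss → ∑ ss (λ s → if p s then 1# else 0#) ≈ natK K (count p ss)
  ∑-count p [] = refl
  ∑-count p (s ∷ ss) with p s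
  ... | true = +-congˡ (∑-count p ss)
  ... | false = trans (+-identityˡ _) (∑-count p ss)

  *-indicator : ∀ x (b : Bool) → x * (if b then 1# else 0#) ≈ (if b then x else 0#)
  *-indicator x true = *-identityʳ x
  *-indicator x false = zeroʳ x

  ∑-treesOfSize-≅ᵇ : ∀ (f : Tree → Carrier) s {n} → size s ≡ n →
                     ∑ (treesOfSize n) (λ t → if s ≅ᵇ t then f t else 0#) ≈ f (canon s)
  ∑-treesOfSize-≅ᵇ f s ≡.refl = begin
    ∑ (treesOfSize (size s)) (λ t → if s ≅ᵇ t then f t else 0#)
      ≈⟨ ∑-cong-All (treesOfSize-canonical (size s)) (λ {t} t-canonical →
           reflexive (≡.cong (λ b → if b then f t else 0#) (≅ᵇ-canonical s t-canonical))) ⟩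
    ∑ (treesOfSize (size s)) (λ t → if does (t ≟ᵀ canon s) then f t else 0#)
      ≈⟨ ∑-indicator f (canon s) (treesOfSize (size s)) ⟩
    natK K (mult _≟ᵀ_ (canon s) (treesOfSize (size s))) * f (canon s)
      ≡⟨ ≡.cong (λ n → natK K n * f (canon s)) (treesOfSize-mult s) ⟩
    natK K 1 * f (canon s)
      ≈⟨ natK-1-* (f (canon s)) ⟩
    f (canon s) ∎

  ∑-treesOfSize-count : ∀ {f : Tree → Carrier} → (∀ s → f s ≈ f (canon s)) →
                        ∀ {n} ss → All (λ s → size s ≡ n) ss →
                        ∑ (treesOfSize n) (λ t → natK K (count (_≅ᵇ t) ss) * f t) ≈ ∑ ss f
  ∑-treesOfSize-count {f} f-inv {n} [] [] = ∑-zero (All.universal (λ _ → zeroˡ _) (treesOfSize n))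
  ∑-treesOfSize-count {f} f-inv {n} (s ∷ ss) (size-s ∷ sizes) = begin
    ∑ (treesOfSize n) (λ t → natK K (count (_≅ᵇ t) (s ∷ ss)) * f t)
      ≈⟨ ∑-cong (treesOfSize n) count-∷ ⟩
    ∑ (treesOfSize n) (λ t → (if s ≅ᵇ t then f t else 0#) + natK K (count (_≅ᵇ t) ss) * f t)
      ≈⟨ ∑-+ (treesOfSize n) _ _ ⟩
    ∑ (treesOfSize n) (λ t → if s ≅ᵇ t then f t else 0#) + ∑ (treesOfSize n) (λ t → natK K (count (_≅ᵇ t) ss) * f t)
      ≈⟨ +-cong (trans (∑-treesOfSize-≅ᵇ f s size-s) (sym (f-inv s))) (∑-treesOfSize-count f-inv ss sizes) ⟩
    f s + ∑ ss f ∎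
    where
    count-∷ : ∀ t → natK K (count (_≅ᵇ t) (s ∷ ss)) * f t
                      ≈ (if s ≅ᵇ t then f t else 0#) + natK K (count (_≅ᵇ t) ss) * f t
    count-∷ t with s ≅ᵇ t
    ... | true = natK-suc-* (count (_≅ᵇ t) ss) (f t)
    ... | false = sym (+-identityˡ _)

  -- Expansions of N and P

  Invariant : (Forest → Carrier) → Set ℓ
  Invariant Φ = ∀ {ss ts} → ss ≃ ts → Φ ss ≈ Φ ts

  Invariant₂ : (Forest → Forest → Carrier) → Set ℓ
  Invariant₂ F = ∀ {as as′ bs bs′} → as ≃ as′ → bs ≃ bs′ → F as bs ≈ F as′ bs′

  Invariantᵀ : (Tree → Carrier) → Set ℓ
  Invariantᵀ Ψ = ∀ {s s′} → canon s ≡ canon s′ → Ψ s ≈ Ψ s′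

  pairing-invariant : ∀ w → Invariant ⟪ w ,_⟫
  pairing-invariant w (iso eq) = reflexive (≡.cong w eq)

  pairing-canonF : ∀ w u → ⟪ w , canonF u ⟫ ≡ ⟪ w , u ⟫
  pairing-canonF w u = ≡.cong w (canonF-idem u)

  ∷-invariant : ∀ {Φ} → Invariant Φ → ∀ t → Invariant (λ ts → Φ (t ∷ ts))
  ∷-invariant Φ-inv t eq = Φ-inv (∷-cong-≃ ≡.refl eq)

  canon-∷-invariant : ∀ {Φ} → Invariant Φ → ∀ s ts → Φ (s ∷ ts) ≈ Φ (canon s ∷ ts)
  canon-∷-invariant Φ-inv s ts = Φ-inv (∷-cong-≃ (≡.sym (canon-idem s)) ≃-refl)

  evalLC : (Forest → Carrier) → LC → Carrier
  evalLC Φ l = ∑₂ l (λ n u → natK K n * Φ u)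

  pairingᴸ-≡-evalLC : ∀ w l → ⟪ w , l ⟫ᴸ ≡ evalLC ⟪ w ,_⟫ l
  pairingᴸ-≡-evalLC w [] = ≡.refl
  pairingᴸ-≡-evalLC w ((n , u) ∷ l) = ≡.cong (natK K n * ⟪ w , u ⟫ +_) (pairingᴸ-≡-evalLC w l)

  evalLC-derivation-∷ : ∀ D Φ t ts →
    evalLC Φ (derivation D (t ∷ ts)) ≈ evalLC (λ g → Φ (g ++ ts)) (D t) + evalLC (λ g → Φ (t ∷ g)) (derivation D ts)
  evalLC-derivation-∷ D Φ t ts =
    trans (∑-++ (map _ (D t)) (map _ (derivation D ts)) _)
          (+-cong (reflexive (∑-map _ (D t) _)) (reflexive (∑-map _ (derivation D ts) _)))

  ∑-graftingsF-∷ : ∀ Φ t ts →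
    ∑ (graftingsF (t ∷ ts)) Φ ≈ ∑ (graftings t) (λ s → Φ (s ∷ ts)) + ∑ (graftingsF ts) (λ g → Φ (t ∷ g))
  ∑-graftingsF-∷ Φ t ts =
    trans (∑-++ (map (_∷ ts) (graftings t)) (map (t ∷_) (graftingsF ts)) Φ)
          (+-cong (reflexive (∑-map (_∷ ts) (graftings t) Φ)) (reflexive (∑-map (t ∷_) (graftingsF ts) Φ)))

  ∑-graftings-node : ∀ (Ψ : Tree → Carrier) ts →
    ∑ (graftings (node ts)) Ψ ≈ Ψ (node (ts ++ [ • ])) + ∑ (graftingsF ts) (λ g → Ψ (node g))
  ∑-graftings-node Ψ ts = +-congˡ (reflexive (∑-map node (graftingsF ts) Ψ))

  ∑-pruningsF-∷ : ∀ Φ t ts →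
    ∑ (pruningsF (t ∷ ts)) Φ ≈ (∑ (if isTerminal t then [ [] ] else []) (λ g → Φ (g ++ ts))
                                 + ∑ (prunings t) (λ s → Φ (s ∷ ts))) + ∑ (pruningsF ts) (λ g → Φ (t ∷ g))
  ∑-pruningsF-∷ Φ t ts = begin
    ∑ (terminal ++ map (_∷ ts) (prunings t) ++ map (t ∷_) (pruningsF ts)) Φ
      ≈⟨ ∑-++ terminal _ Φ ⟩
    ∑ terminal Φ + ∑ (map (_∷ ts) (prunings t) ++ map (t ∷_) (pruningsF ts)) Φ
      ≈⟨ +-cong (reflexive (terminal-part t)) (∑-++ (map (_∷ ts) (prunings t)) _ Φ) ⟩
    ∑ (if isTerminal t then [ [] ] else []) (λ g → Φ (g ++ ts))
      + (∑ (map (_∷ ts) (prunings t)) Φ + ∑ (map (t ∷_) (pruningsF ts)) Φ)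
      ≈⟨ sym (+-assoc _ _ _) ⟩
    (∑ (if isTerminal t then [ [] ] else []) (λ g → Φ (g ++ ts)) + ∑ (map (_∷ ts) (prunings t)) Φ)
      + ∑ (map (t ∷_) (pruningsF ts)) Φ
      ≈⟨ +-cong (+-congˡ (reflexive (∑-map (_∷ ts) (prunings t) Φ))) (reflexive (∑-map (t ∷_) (pruningsF ts) Φ)) ⟩
    (∑ (if isTerminal t then [ [] ] else []) (λ g → Φ (g ++ ts)) + ∑ (prunings t) (λ s → Φ (s ∷ ts)))
      + ∑ (pruningsF ts) (λ g → Φ (t ∷ g)) ∎
    where
    terminal = if isTerminal t then [ ts ] else []
    terminal-part : ∀ t → ∑ (if isTerminal t then [ ts ] else []) Φ
                            ≡ ∑ (if isTerminal t then [ [] ] else []) (λ g → Φ (g ++ ts))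
    terminal-part (node []) = ≡.refl
    terminal-part (node (_ ∷ _)) = ≡.refl

  evalLC-Ntree : ∀ {Ψ} → (∀ s → Ψ [ s ] ≈ Ψ [ canon s ]) → ∀ t →
                 evalLC Ψ (Ntree t) ≈ ∑ (graftings t) (λ s → Ψ [ s ])
  evalLC-Ntree Ψ-inv t =
    trans (reflexive (∑-map _ (treesOfSize (suc (size t))) _)) (∑-treesOfSize-count Ψ-inv (graftings t) (graftings-size t))

  evalLC-Ptree : ∀ {Ψ} → (∀ s → Ψ [ s ] ≈ Ψ [ canon s ]) → ∀ t →
    evalLC Ψ (Ptree t) ≈ ∑ (if isTerminal t then [ [] ] else []) Ψ + ∑ (prunings t) (λ s → Ψ [ s ])
  evalLC-Ptree Ψ-inv (node []) = +-congʳ (trans (natK-1-* _) (sym (+-identityʳ _)))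
  evalLC-Ptree Ψ-inv t@(node (_ ∷ _)) =
    trans (reflexive (∑-map _ (treesOfSize (size t ∸ 1)) _))
          (trans (∑-treesOfSize-count Ψ-inv (prunings t) (All.map (≡.cong (_∸ 1)) (prunings-size t)))
                 (sym (+-identityˡ _)))

  evalLC-N : ∀ {Φ} → Invariant Φ → ∀ ts → evalLC Φ (N ts) ≈ ∑ (graftingsF ts) Φ
  evalLC-N Φ-inv [] = refl
  evalLC-N {Φ} Φ-inv (t ∷ ts) = begin
    evalLC Φ (N (t ∷ ts))
      ≈⟨ evalLC-derivation-∷ Ntree Φ t ts ⟩
    evalLC (λ g → Φ (g ++ ts)) (Ntree t) + evalLC (λ g → Φ (t ∷ g)) (N ts)
      ≈⟨ +-cong (evalLC-Ntree (λ s → canon-∷-invariant Φ-inv s ts) t) (evalLC-N (∷-invariant Φ-inv t) ts) ⟩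
    ∑ (graftings t) (λ s → Φ (s ∷ ts)) + ∑ (graftingsF ts) (λ g → Φ (t ∷ g))
      ≈⟨ ∑-graftingsF-∷ Φ t ts ⟨
    ∑ (graftingsF (t ∷ ts)) Φ ∎

  evalLC-P : ∀ {Φ} → Invariant Φ → ∀ ts → evalLC Φ (P ts) ≈ ∑ (pruningsF ts) Φ
  evalLC-P Φ-inv [] = refl
  evalLC-P {Φ} Φ-inv (t ∷ ts) = begin
    evalLC Φ (P (t ∷ ts))
      ≈⟨ evalLC-derivation-∷ Ptree Φ t ts ⟩
    evalLC (λ g → Φ (g ++ ts)) (Ptree t) + evalLC (λ g → Φ (t ∷ g)) (P ts)
      ≈⟨ +-cong (evalLC-Ptree (λ s → canon-∷-invariant Φ-inv s ts) t) (evalLC-P (∷-invariant Φ-inv t) ts) ⟩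
    (∑ (if isTerminal t then [ [] ] else []) (λ g → Φ (g ++ ts)) + ∑ (prunings t) (λ s → Φ (s ∷ ts)))
      + ∑ (pruningsF ts) (λ g → Φ (t ∷ g))
      ≈⟨ ∑-pruningsF-∷ Φ t ts ⟨
    ∑ (pruningsF (t ∷ ts)) Φ ∎

  N*-expansion : ∀ w u → N* w u ≈ ∑ (graftingsF u) ⟪ w ,_⟫
  N*-expansion w u = trans (reflexive (pairingᴸ-≡-evalLC w (N u))) (evalLC-N (pairing-invariant w) u)

  P*-expansion : ∀ w u → P* w u ≈ ∑ (pruningsF u) ⟪ w ,_⟫
  P*-expansion w u = trans (reflexive (pairingᴸ-≡-evalLC w (P u))) (evalLC-P (pairing-invariant w) u)

  -- Independence of the planar representative

  ∑-graftingsF-↭ : ∀ {Φ} → Invariant Φ → ∀ {ss ts} → ss ↭ ts → ∑ (graftingsF ss) Φ ≈ ∑ (graftingsF ts) Φ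
  ∑-graftingsF-↭ Φ-inv ↭.refl = refl
  ∑-graftingsF-↭ {Φ} Φ-inv (↭.prep {xs} {ys} t xs↭ys) = begin
    ∑ (graftingsF (t ∷ xs)) Φ
      ≈⟨ ∑-graftingsF-∷ Φ t xs ⟩
    ∑ (graftings t) (λ s → Φ (s ∷ xs)) + ∑ (graftingsF xs) (λ g → Φ (t ∷ g))
      ≈⟨ +-cong (∑-cong (graftings t) (λ s → Φ-inv (↭⇒≃ (↭.prep s xs↭ys))))
                (∑-graftingsF-↭ (∷-invariant Φ-inv t) xs↭ys) ⟩
    ∑ (graftings t) (λ s → Φ (s ∷ ys)) + ∑ (graftingsF ys) (λ g → Φ (t ∷ g))
      ≈⟨ ∑-graftingsF-∷ Φ t ys ⟨
    ∑ (graftingsF (t ∷ ys)) Φ ∎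
  ∑-graftingsF-↭ {Φ} Φ-inv (↭.swap {xs} {ys} s t xs↭ys) = begin
    ∑ (graftingsF (s ∷ t ∷ xs)) Φ
      ≈⟨ trans (∑-graftingsF-∷ Φ s (t ∷ xs)) (+-congˡ (∑-graftingsF-∷ (λ g → Φ (s ∷ g)) t xs)) ⟩
    ∑ (graftings s) (λ s′ → Φ (s′ ∷ t ∷ xs)) + (∑ (graftings t) (λ t′ → Φ (s ∷ t′ ∷ xs)) + ∑ (graftingsF xs) (λ g → Φ (s ∷ t ∷ g)))
      ≈⟨ x∙yz≈y∙xz _ _ _ ⟩
    ∑ (graftings t) (λ t′ → Φ (s ∷ t′ ∷ xs)) + (∑ (graftings s) (λ s′ → Φ (s′ ∷ t ∷ xs)) + ∑ (graftingsF xs) (λ g → Φ (s ∷ t ∷ g)))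
      ≈⟨ +-cong (∑-cong (graftings t) (λ t′ → Φ-inv (↭⇒≃ (↭.swap s t′ xs↭ys))))
           (+-cong (∑-cong (graftings s) (λ s′ → Φ-inv (↭⇒≃ (↭.swap s′ t xs↭ys))))
                   (trans (∑-graftingsF-↭ (∷-invariant (∷-invariant Φ-inv s) t) xs↭ys)
                          (∑-cong (graftingsF ys) (λ g → Φ-inv (↭⇒≃ (↭.swap s t ↭.refl)))))) ⟩
    ∑ (graftings t) (λ t′ → Φ (t′ ∷ s ∷ ys)) + (∑ (graftings s) (λ s′ → Φ (t ∷ s′ ∷ ys)) + ∑ (graftingsF ys) (λ g → Φ (t ∷ s ∷ g)))
      ≈⟨ trans (∑-graftingsF-∷ Φ t (s ∷ ys)) (+-congˡ (∑-graftingsF-∷ (λ g → Φ (t ∷ g)) s ys)) ⟨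
    ∑ (graftingsF (t ∷ s ∷ ys)) Φ ∎
  ∑-graftingsF-↭ Φ-inv (↭.trans ss↭rs rs↭ts) = trans (∑-graftingsF-↭ Φ-inv ss↭rs) (∑-graftingsF-↭ Φ-inv rs↭ts)

  mutual
    ∑-graftings-canon : ∀ {Ψ} → Invariantᵀ Ψ → ∀ t → ∑ (graftings t) Ψ ≈ ∑ (graftings (canon t)) Ψ
    ∑-graftings-canon {Ψ} Ψ-inv (node ts) = begin
      ∑ (graftings (node ts)) Ψ
        ≈⟨ ∑-graftings-node Ψ ts ⟩
      Ψ (node (ts ++ [ • ])) + ∑ (graftingsF ts) (λ g → Ψ (node g))
        ≈⟨ +-cong (Ψ-inv (≡.cong node (_≃_.same-canonF (++-cong-≃ (≃-sym (canonF-≃ ts)) ≃-refl))))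
                  (∑-graftingsF-canonF (λ eq → Ψ-inv (≡.cong node (_≃_.same-canonF eq))) ts) ⟩
      Ψ (node (canonF ts ++ [ • ])) + ∑ (graftingsF (canonF ts)) (λ g → Ψ (node g))
        ≈⟨ ∑-graftings-node Ψ (canonF ts) ⟨
      ∑ (graftings (node (canonF ts))) Ψ ∎

    ∑-graftingsF-canonL : ∀ {Φ} → Invariant Φ → ∀ ts → ∑ (graftingsF ts) Φ ≈ ∑ (graftingsF (canonL ts)) Φ
    ∑-graftingsF-canonL Φ-inv [] = refl
    ∑-graftingsF-canonL {Φ} Φ-inv (t ∷ ts) = begin
      ∑ (graftingsF (t ∷ ts)) Φ
        ≈⟨ ∑-graftingsF-∷ Φ t ts ⟩
      ∑ (graftings t) (λ s → Φ (s ∷ ts)) + ∑ (graftingsF ts) (λ g → Φ (t ∷ g))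
        ≈⟨ +-cong (trans (∑-cong (graftings t) (λ s → Φ-inv (∷-cong-≃ ≡.refl (≃-sym (canonL-≃ ts)))))
                         (∑-graftings-canon (λ eq → Φ-inv (∷-cong-≃ eq ≃-refl)) t))
                  (trans (∑-graftingsF-canonL (∷-invariant Φ-inv t) ts)
                         (∑-cong (graftingsF (canonL ts)) (λ g → canon-∷-invariant Φ-inv t g))) ⟩
      ∑ (graftings (canon t)) (λ s → Φ (s ∷ canonL ts)) + ∑ (graftingsF (canonL ts)) (λ g → Φ (canon t ∷ g))
        ≈⟨ ∑-graftingsF-∷ Φ (canon t) (canonL ts) ⟨
      ∑ (graftingsF (canon t ∷ canonL ts)) Φ ∎

    ∑-graftingsF-canonF : ∀ {Φ} → Invariant Φ → ∀ ts → ∑ (graftingsF ts) Φ ≈ ∑ (graftingsF (canonF ts)) Φ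
    ∑-graftingsF-canonF Φ-inv ts =
      trans (∑-graftingsF-canonL Φ-inv ts) (∑-graftingsF-↭ Φ-inv (↭-sym (sortT-↭ (canonL ts))))

  ∑-graftingsF-invariant : ∀ {Φ} → Invariant Φ → Invariant (λ ts → ∑ (graftingsF ts) Φ)
  ∑-graftingsF-invariant {Φ} Φ-inv {ss} {ts} (iso eq) = begin
    ∑ (graftingsF ss) Φ           ≈⟨ ∑-graftingsF-canonF Φ-inv ss ⟩
    ∑ (graftingsF (canonF ss)) Φ  ≡⟨ ≡.cong (λ us → ∑ (graftingsF us) Φ) eq ⟩
    ∑ (graftingsF (canonF ts)) Φ  ≈⟨ ∑-graftingsF-canonF Φ-inv ts ⟨
    ∑ (graftingsF ts) Φ           ∎

  ∑Δt-node : ∀ F ts → ∑₂ (Δt (node ts)) F ≈ F [ node ts ] [] + ∑₂ (Δ ts) (λ as bs → F as [ node bs ])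
  ∑Δt-node F ts = +-congˡ (trans (reflexive (∑-map _ (Δ ts) _)) (∑-cong (Δ ts) (λ { (as , bs) → refl })))

  ∑Δ-∷ : ∀ F t ts →
         ∑₂ (Δ (t ∷ ts)) F ≈ ∑₂ (Δt t) (λ as bs → ∑₂ (Δ ts) (λ as′ bs′ → F (as ++ as′) (bs ++ bs′)))
  ∑Δ-∷ F t ts = trans (∑-concatMap _ (Δt t) _) (∑-cong (Δt t) (λ { (as , bs) →
    trans (reflexive (∑-map _ (Δ ts) _)) (∑-cong (Δ ts) (λ { (as′ , bs′) → refl })) }))

  ++-invariant₂ : ∀ {F} → Invariant₂ F → ∀ as bs → Invariant₂ (λ as′ bs′ → F (as ++ as′) (bs ++ bs′))
  ++-invariant₂ F-inv as bs eq eq′ = F-inv (++-cong-≃ ≃-refl eq) (++-cong-≃ ≃-refl eq′)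

  ∑Δ-invariant₂ : ∀ {F} → Invariant₂ F → ∀ L →
                  Invariant₂ (λ as bs → ∑₂ L (λ as′ bs′ → F (as ++ as′) (bs ++ bs′)))
  ∑Δ-invariant₂ F-inv L eq eq′ = ∑-cong L (λ { (as′ , bs′) → F-inv (++-cong-≃ eq ≃-refl) (++-cong-≃ eq′ ≃-refl) })

  ∑Δ-↭ : ∀ {F} → Invariant₂ F → ∀ {ss ts} → ss ↭ ts → ∑₂ (Δ ss) F ≈ ∑₂ (Δ ts) F
  ∑Δ-↭ F-inv ↭.refl = refl
  ∑Δ-↭ {F} F-inv (↭.prep {xs} {ys} t xs↭ys) =
    trans (∑Δ-∷ F t xs) (trans (∑-cong (Δt t) (λ { (as , bs) → ∑Δ-↭ (++-invariant₂ F-inv as bs) xs↭ys }))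
                               (sym (∑Δ-∷ F t ys)))
  ∑Δ-↭ {F} F-inv (↭.swap {xs} {ys} s t xs↭ys) = begin
    ∑₂ (Δ (s ∷ t ∷ xs)) F
      ≈⟨ ∑Δ-∷ F s (t ∷ xs) ⟩
    ∑₂ (Δt s) (λ as bs → ∑₂ (Δ (t ∷ xs)) (λ as′ bs′ → F (as ++ as′) (bs ++ bs′)))
      ≈⟨ ∑-cong (Δt s) (λ { (as , bs) → trans (∑Δ-∷ _ t xs) (∑-cong (Δt t) (λ { (as′ , bs′) →
           ∑Δ-↭ (++-invariant₂ (++-invariant₂ F-inv as bs) as′ bs′) xs↭ys })) }) ⟩
    ∑₂ (Δt s) (λ as bs → ∑₂ (Δt t) (λ as′ bs′ → ∑₂ (Δ ys) (λ as″ bs″ → F (as ++ as′ ++ as″) (bs ++ bs′ ++ bs″))))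
      ≈⟨ ∑-comm (Δt s) (Δt t) _ ⟩
    ∑₂ (Δt t) (λ as′ bs′ → ∑₂ (Δt s) (λ as bs → ∑₂ (Δ ys) (λ as″ bs″ → F (as ++ as′ ++ as″) (bs ++ bs′ ++ bs″))))
      ≈⟨ ∑-cong (Δt t) (λ { (as′ , bs′) → ∑-cong (Δt s) (λ { (as , bs) → ∑-cong (Δ ys) (λ { (as″ , bs″) →
           F-inv (↭⇒≃ (↭ₚ.shifts as as′)) (↭⇒≃ (↭ₚ.shifts bs bs′)) }) }) }) ⟩
    ∑₂ (Δt t) (λ as′ bs′ → ∑₂ (Δt s) (λ as bs → ∑₂ (Δ ys) (λ as″ bs″ → F (as′ ++ as ++ as″) (bs′ ++ bs ++ bs″))))
      ≈⟨ ∑-cong (Δt t) (λ { (as′ , bs′) → ∑Δ-∷ _ s ys }) ⟨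
    ∑₂ (Δt t) (λ as′ bs′ → ∑₂ (Δ (s ∷ ys)) (λ as bs → F (as′ ++ as) (bs′ ++ bs)))
      ≈⟨ ∑Δ-∷ F t (s ∷ ys) ⟨
    ∑₂ (Δ (t ∷ s ∷ ys)) F ∎
  ∑Δ-↭ F-inv (↭.trans ss↭rs rs↭ts) = trans (∑Δ-↭ F-inv ss↭rs) (∑Δ-↭ F-inv rs↭ts)

  mutual
    ∑Δt-canon : ∀ {F} → Invariant₂ F → ∀ t → ∑₂ (Δt t) F ≈ ∑₂ (Δt (canon t)) F
    ∑Δt-canon {F} F-inv (node ts) =
      trans (∑Δt-node F ts)
            (trans (+-cong (F-inv (node-cong-≃ (≃-sym (canonF-≃ ts))) ≃-refl)
                           (∑Δ-canonF (λ eq eq′ → F-inv eq (node-cong-≃ eq′)) ts))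
                   (sym (∑Δt-node F (canonF ts))))

    ∑Δ-canonL : ∀ {F} → Invariant₂ F → ∀ ts → ∑₂ (Δ ts) F ≈ ∑₂ (Δ (canonL ts)) F
    ∑Δ-canonL F-inv [] = refl
    ∑Δ-canonL {F} F-inv (t ∷ ts) = begin
      ∑₂ (Δ (t ∷ ts)) F
        ≈⟨ ∑Δ-∷ F t ts ⟩
      ∑₂ (Δt t) (λ as bs → ∑₂ (Δ ts) (λ as′ bs′ → F (as ++ as′) (bs ++ bs′)))
        ≈⟨ ∑-cong (Δt t) (λ { (as , bs) → ∑Δ-canonL (++-invariant₂ F-inv as bs) ts }) ⟩
      ∑₂ (Δt t) (λ as bs → ∑₂ (Δ (canonL ts)) (λ as′ bs′ → F (as ++ as′) (bs ++ bs′)))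
        ≈⟨ ∑Δt-canon (∑Δ-invariant₂ F-inv (Δ (canonL ts))) t ⟩
      ∑₂ (Δt (canon t)) (λ as bs → ∑₂ (Δ (canonL ts)) (λ as′ bs′ → F (as ++ as′) (bs ++ bs′)))
        ≈⟨ ∑Δ-∷ F (canon t) (canonL ts) ⟨
      ∑₂ (Δ (canon t ∷ canonL ts)) F ∎

    ∑Δ-canonF : ∀ {F} → Invariant₂ F → ∀ ts → ∑₂ (Δ ts) F ≈ ∑₂ (Δ (canonF ts)) F
    ∑Δ-canonF F-inv ts = trans (∑Δ-canonL F-inv ts) (∑Δ-↭ F-inv (↭-sym (sortT-↭ (canonL ts))))

  ∑Δ-invariant : ∀ {F} → Invariant₂ F → Invariant (λ ts → ∑₂ (Δ ts) F)
  ∑Δ-invariant {F} F-inv {ss} {ts} (iso eq) = begin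
    ∑₂ (Δ ss) F           ≈⟨ ∑Δ-canonF F-inv ss ⟩
    ∑₂ (Δ (canonF ss)) F  ≡⟨ ≡.cong (λ us → ∑₂ (Δ us) F) eq ⟩
    ∑₂ (Δ (canonF ts)) F  ≈⟨ ∑Δ-canonF F-inv ts ⟨
    ∑₂ (Δ ts) F           ∎

  -- Grafting and the coproduct

  ∑-graftingsF-[-] : ∀ Φ t → ∑ (graftingsF [ t ]) Φ ≈ ∑ (graftings t) (λ s → Φ [ s ])
  ∑-graftingsF-[-] Φ t = trans (∑-graftingsF-∷ Φ t []) (+-identityʳ _)

  ∑-graftingsF-++ : ∀ Φ ss ts →
    ∑ (graftingsF (ss ++ ts)) Φ ≈ ∑ (graftingsF ss) (λ g → Φ (g ++ ts)) + ∑ (graftingsF ts) (λ g → Φ (ss ++ g))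
  ∑-graftingsF-++ Φ [] ts = sym (+-identityˡ _)
  ∑-graftingsF-++ Φ (s ∷ ss) ts = begin
    ∑ (graftingsF (s ∷ ss ++ ts)) Φ
      ≈⟨ ∑-graftingsF-∷ Φ s (ss ++ ts) ⟩
    ∑ (graftings s) (λ s′ → Φ (s′ ∷ ss ++ ts)) + ∑ (graftingsF (ss ++ ts)) (λ g → Φ (s ∷ g))
      ≈⟨ +-congˡ (∑-graftingsF-++ (λ g → Φ (s ∷ g)) ss ts) ⟩
    ∑ (graftings s) (λ s′ → Φ (s′ ∷ ss ++ ts))
      + (∑ (graftingsF ss) (λ g → Φ (s ∷ g ++ ts)) + ∑ (graftingsF ts) (λ g → Φ (s ∷ ss ++ g)))
      ≈⟨ +-assoc _ _ _ ⟨
    (∑ (graftings s) (λ s′ → Φ (s′ ∷ ss ++ ts)) + ∑ (graftingsF ss) (λ g → Φ (s ∷ g ++ ts)))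
      + ∑ (graftingsF ts) (λ g → Φ (s ∷ ss ++ g))
      ≈⟨ +-congʳ (∑-graftingsF-∷ (λ g → Φ (g ++ ts)) s ss) ⟨
    ∑ (graftingsF (s ∷ ss)) (λ g → Φ (g ++ ts)) + ∑ (graftingsF ts) (λ g → Φ (s ∷ ss ++ g)) ∎

  ∑Δ-++ : ∀ F ss ts →
          ∑₂ (Δ (ss ++ ts)) F ≈ ∑₂ (Δ ss) (λ as bs → ∑₂ (Δ ts) (λ as′ bs′ → F (as ++ as′) (bs ++ bs′)))
  ∑Δ-++ F [] ts = sym (+-identityʳ _)
  ∑Δ-++ F (s ∷ ss) ts = begin
    ∑₂ (Δ (s ∷ ss ++ ts)) F
      ≈⟨ ∑Δ-∷ F s (ss ++ ts) ⟩
    ∑₂ (Δt s) (λ as bs → ∑₂ (Δ (ss ++ ts)) (λ as′ bs′ → F (as ++ as′) (bs ++ bs′)))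
      ≈⟨ ∑-cong (Δt s) (λ { (as , bs) → ∑Δ-++ (λ as′ bs′ → F (as ++ as′) (bs ++ bs′)) ss ts }) ⟩
    ∑₂ (Δt s) (λ as bs → ∑₂ (Δ ss) (λ as′ bs′ → ∑₂ (Δ ts) (λ as″ bs″ → F (as ++ as′ ++ as″) (bs ++ bs′ ++ bs″))))
      ≈⟨ ∑-cong (Δt s) (λ { (as , bs) → ∑-cong (Δ ss) (λ { (as′ , bs′) → ∑-cong (Δ ts) (λ { (as″ , bs″) →
           reflexive (≡.cong₂ F (≡.sym (++-assoc as as′ as″)) (≡.sym (++-assoc bs bs′ bs″))) }) }) }) ⟩
    ∑₂ (Δt s) (λ as bs → ∑₂ (Δ ss) (λ as′ bs′ → ∑₂ (Δ ts) (λ as″ bs″ → F ((as ++ as′) ++ as″) ((bs ++ bs′) ++ bs″))))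
      ≈⟨ ∑Δ-∷ (λ as bs → ∑₂ (Δ ts) (λ as′ bs′ → F (as ++ as′) (bs ++ bs′))) s ss ⟨
    ∑₂ (Δ (s ∷ ss)) (λ as bs → ∑₂ (Δ ts) (λ as′ bs′ → F (as ++ as′) (bs ++ bs′))) ∎

  ∑Δ-∷ʳ-• : ∀ {F} → Invariant₂ F → ∀ ts →
            ∑₂ (Δ (ts ++ [ • ])) F ≈ ∑₂ (Δ ts) (λ as bs → F (• ∷ as) bs + F as (bs ++ [ • ]))
  ∑Δ-∷ʳ-• {F} F-inv ts = trans (∑Δ-++ F ts [ • ]) (∑-cong (Δ ts) (λ { (as , bs) →
    +-cong (F-inv (↭⇒≃ (↭ₚ.++-comm as [ • ])) (iso (≡.cong canonF (++-identityʳ bs))))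
           (trans (+-identityʳ _) (reflexive (≡.cong (λ as′ → F as′ (bs ++ [ • ])) (++-identityʳ as)))) }))

  -- F ∘ (N ⊗ id + id ⊗ N + (• ·) ⊗ deg), for a functional F on H_K ⊗ H_K given on pairs of monomials
  N⊗ : (Forest → Forest → Carrier) → Forest → Forest → Carrier
  N⊗ F as bs = (∑ (graftingsF as) (λ as′ → F as′ bs) + ∑ (graftingsF bs) (F as)) + natK K (sizeF bs) * F (• ∷ as) bs

  N⊗-∑ : ∀ {A : Set} (H : A → Forest → Forest → Carrier) L as bs →
         N⊗ (λ as′ bs′ → ∑ L (λ y → H y as′ bs′)) as bs ≈ ∑ L (λ y → N⊗ (H y) as bs)
  N⊗-∑ H L as bs = begin
    (∑ (graftingsF as) (λ as′ → ∑ L (λ y → H y as′ bs)) + ∑ (graftingsF bs) (λ bs′ → ∑ L (λ y → H y as bs′)))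
      + natK K (sizeF bs) * ∑ L (λ y → H y (• ∷ as) bs)
      ≈⟨ +-cong (+-cong (∑-comm (graftingsF as) L _) (∑-comm (graftingsF bs) L _)) (∑-*ˡ _ L _) ⟩
    (∑ L (λ y → ∑ (graftingsF as) (λ as′ → H y as′ bs)) + ∑ L (λ y → ∑ (graftingsF bs) (H y as)))
      + ∑ L (λ y → natK K (sizeF bs) * H y (• ∷ as) bs)
      ≈⟨ trans (+-congʳ (sym (∑-+ L _ _))) (sym (∑-+ L _ _)) ⟩
    ∑ L (λ y → N⊗ (H y) as bs) ∎

  N⊗-++ : ∀ {F} → Invariant₂ F → ∀ as bs as′ bs′ →
    N⊗ (λ as″ bs″ → F (as″ ++ as′) (bs″ ++ bs′)) as bs + N⊗ (λ as″ bs″ → F (as ++ as″) (bs ++ bs″)) as′ bs′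
      ≈ N⊗ F (as ++ as′) (bs ++ bs′)
  N⊗-++ {F} F-inv as bs as′ bs′ = begin
    ((∑ (graftingsF as) (λ as″ → F (as″ ++ as′) (bs ++ bs′)) + ∑ (graftingsF bs) (λ bs″ → F (as ++ as′) (bs″ ++ bs′)))
      + natK K (sizeF bs) * F ((• ∷ as) ++ as′) (bs ++ bs′))
    + ((∑ (graftingsF as′) (λ as″ → F (as ++ as″) (bs ++ bs′)) + ∑ (graftingsF bs′) (λ bs″ → F (as ++ as′) (bs ++ bs″)))
      + natK K (sizeF bs′) * F (as ++ • ∷ as′) (bs ++ bs′))
      ≈⟨ +-congˡ (+-congˡ (*-congˡ (F-inv (↭⇒≃ (↭ₚ.shift • as as′)) ≃-refl))) ⟩
    ((∑ (graftingsF as) (λ as″ → F (as″ ++ as′) (bs ++ bs′)) + ∑ (graftingsF bs) (λ bs″ → F (as ++ as′) (bs″ ++ bs′)))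
      + natK K (sizeF bs) * F (• ∷ as ++ as′) (bs ++ bs′))
    + ((∑ (graftingsF as′) (λ as″ → F (as ++ as″) (bs ++ bs′)) + ∑ (graftingsF bs′) (λ bs″ → F (as ++ as′) (bs ++ bs″)))
      + natK K (sizeF bs′) * F (• ∷ as ++ as′) (bs ++ bs′))
      ≈⟨ regroup _ _ _ _ _ _ _ ⟩
    ((∑ (graftingsF as) (λ as″ → F (as″ ++ as′) (bs ++ bs′)) + ∑ (graftingsF as′) (λ as″ → F (as ++ as″) (bs ++ bs′)))
      + (∑ (graftingsF bs) (λ bs″ → F (as ++ as′) (bs″ ++ bs′)) + ∑ (graftingsF bs′) (λ bs″ → F (as ++ as′) (bs ++ bs″))))
      + (natK K (sizeF bs) + natK K (sizeF bs′)) * F (• ∷ as ++ as′) (bs ++ bs′)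
      ≈⟨ +-cong (+-cong (sym (∑-graftingsF-++ (λ as″ → F as″ (bs ++ bs′)) as as′))
                        (sym (∑-graftingsF-++ (F (as ++ as′)) bs bs′)))
                (*-congʳ (sym (trans (reflexive (≡.cong (natK K) (sizeF-++ bs bs′))) (natK-+ (sizeF bs) (sizeF bs′))))) ⟩
    N⊗ F (as ++ as′) (bs ++ bs′) ∎
    where
    regroup : ∀ p q m z p′ q′ m′ → ((p + q) + m * z) + ((p′ + q′) + m′ * z) ≈ ((p + p′) + (q + q′)) + (m + m′) * z
    regroup = solve 7 (λ p q m z p′ q′ m′ → ((p :+ q) :+ m :* z) :+ ((p′ :+ q′) :+ m′ :* z)
                                         := ((p :+ p′) :+ (q :+ q′)) :+ (m :+ m′) :* z) refl

  N⊗-[node] : ∀ {F} → Invariant₂ F → ∀ as bs →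
    N⊗ F as [ node bs ]
      ≈ (F (• ∷ as) [ node bs ] + F as [ node (bs ++ [ • ]) ]) + N⊗ (λ as′ bs′ → F as′ [ node bs′ ]) as bs
  N⊗-[node] {F} F-inv as bs = begin
    (∑ (graftingsF as) (λ as′ → F as′ [ node bs ]) + ∑ (graftingsF [ node bs ]) (F as))
      + natK K (suc (sizeF bs +ℕ 0)) * F (• ∷ as) [ node bs ]
      ≈⟨ +-cong (+-congˡ (trans (∑-graftingsF-[-] (F as) (node bs)) (∑-graftings-node (λ s → F as [ s ]) bs)))
                (trans (natK-suc-* (sizeF bs +ℕ 0) _) (+-congˡ (*-congʳ (reflexive (≡.cong (natK K) (ℕ.+-identityʳ (sizeF bs))))))) ⟩
    (∑ (graftingsF as) (λ as′ → F as′ [ node bs ]) + (F as [ node (bs ++ [ • ]) ] + ∑ (graftingsF bs) (λ bs′ → F as [ node bs′ ])))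
      + (F (• ∷ as) [ node bs ] + natK K (sizeF bs) * F (• ∷ as) [ node bs ])
      ≈⟨ regroup _ _ _ _ _ ⟩
    (F (• ∷ as) [ node bs ] + F as [ node (bs ++ [ • ]) ])
      + ((∑ (graftingsF as) (λ as′ → F as′ [ node bs ]) + ∑ (graftingsF bs) (λ bs′ → F as [ node bs′ ]))
        + natK K (sizeF bs) * F (• ∷ as) [ node bs ]) ∎
    where
    regroup : ∀ x y z u v → (x + (y + z)) + (u + v) ≈ (u + y) + ((x + z) + v)
    regroup = solve 5 (λ x y z u v → (x :+ (y :+ z)) :+ (u :+ v) := (u :+ y) :+ ((x :+ z) :+ v)) refl

  mutual
    ∑Δt-graftings : ∀ {F} → Invariant₂ F → ∀ t → ∑ (graftings t) (λ s → ∑₂ (Δt s) F) ≈ ∑₂ (Δt t) (N⊗ F)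
    ∑Δt-graftings {F} F-inv (node ts) = begin
      ∑ (graftings (node ts)) (λ s → ∑₂ (Δt s) F)
        ≈⟨ ∑-graftings-node (λ s → ∑₂ (Δt s) F) ts ⟩
      ∑₂ (Δt (node (ts ++ [ • ]))) F + ∑ (graftingsF ts) (λ g → ∑₂ (Δt (node g)) F)
        ≈⟨ +-cong (∑Δt-node F (ts ++ [ • ])) (∑-cong (graftingsF ts) (∑Δt-node F)) ⟩
      (F [ node (ts ++ [ • ]) ] [] + ∑₂ (Δ (ts ++ [ • ])) F′) + ∑ (graftingsF ts) (λ g → F [ node g ] [] + ∑₂ (Δ g) F′)
        ≈⟨ +-cong (+-congˡ (∑Δ-∷ʳ-• F′-inv ts)) (∑-+ (graftingsF ts) _ _) ⟩
      (F [ node (ts ++ [ • ]) ] [] + ∑₂ (Δ ts) W)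
        + (∑ (graftingsF ts) (λ g → F [ node g ] []) + ∑ (graftingsF ts) (λ g → ∑₂ (Δ g) F′))
        ≈⟨ +-congˡ (+-congˡ (∑Δ-graftingsF F′-inv ts)) ⟩
      (F [ node (ts ++ [ • ]) ] [] + ∑₂ (Δ ts) W) + (∑ (graftingsF ts) (λ g → F [ node g ] []) + ∑₂ (Δ ts) (N⊗ F′))
        ≈⟨ interchange _ _ _ _ ⟩
      (F [ node (ts ++ [ • ]) ] [] + ∑ (graftingsF ts) (λ g → F [ node g ] [])) + (∑₂ (Δ ts) W + ∑₂ (Δ ts) (N⊗ F′))
        ≈⟨ +-cong (sym N⊗-[node]-[]) (trans (sym (∑-+ (Δ ts) _ _)) (∑-cong (Δ ts) (λ { (as , bs) → sym (N⊗-[node] F-inv as bs) }))) ⟩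
      N⊗ F [ node ts ] [] + ∑₂ (Δ ts) (λ as bs → N⊗ F as [ node bs ])
        ≈⟨ ∑Δt-node (N⊗ F) ts ⟨
      ∑₂ (Δt (node ts)) (N⊗ F) ∎
      where
      F′ : Forest → Forest → Carrier
      F′ as bs = F as [ node bs ]
      F′-inv : Invariant₂ F′
      F′-inv eq eq′ = F-inv eq (node-cong-≃ eq′)
      W : Forest → Forest → Carrier
      W as bs = F′ (• ∷ as) bs + F′ as (bs ++ [ • ])
      N⊗-[node]-[] : N⊗ F [ node ts ] [] ≈ F [ node (ts ++ [ • ]) ] [] + ∑ (graftingsF ts) (λ g → F [ node g ] [])
      N⊗-[node]-[] = begin
        (∑ (graftingsF [ node ts ]) (λ as → F as []) + 0#) + natK K 0 * F (• ∷ [ node ts ]) []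
          ≈⟨ trans (+-cong (+-identityʳ _) (zeroˡ _)) (+-identityʳ _) ⟩
        ∑ (graftingsF [ node ts ]) (λ as → F as [])
          ≈⟨ trans (∑-graftingsF-[-] (λ as → F as []) (node ts)) (∑-graftings-node (λ s → F [ s ] []) ts) ⟩
        F [ node (ts ++ [ • ]) ] [] + ∑ (graftingsF ts) (λ g → F [ node g ] []) ∎

    ∑Δ-graftingsF : ∀ {F} → Invariant₂ F → ∀ ts → ∑ (graftingsF ts) (λ g → ∑₂ (Δ g) F) ≈ ∑₂ (Δ ts) (N⊗ F)
    ∑Δ-graftingsF F-inv [] = sym (trans (+-identityʳ _) (trans (+-cong (+-identityʳ _) (zeroˡ _)) (+-identityʳ _)))
    ∑Δ-graftingsF {F} F-inv (t ∷ ts) = begin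
      ∑ (graftingsF (t ∷ ts)) (λ g → ∑₂ (Δ g) F)
        ≈⟨ ∑-graftingsF-∷ (λ g → ∑₂ (Δ g) F) t ts ⟩
      ∑ (graftings t) (λ s → ∑₂ (Δ (s ∷ ts)) F) + ∑ (graftingsF ts) (λ g → ∑₂ (Δ (t ∷ g)) F)
        ≈⟨ +-cong (trans (∑-cong (graftings t) (λ s → ∑Δ-∷ F s ts)) (∑Δt-graftings (∑Δ-invariant₂ F-inv (Δ ts)) t))
                  (trans (∑-cong (graftingsF ts) (∑Δ-∷ F t))
                         (trans (∑-comm (graftingsF ts) (Δt t) _)
                                (∑-cong (Δt t) (λ { (as , bs) → ∑Δ-graftingsF (++-invariant₂ F-inv as bs) ts })))) ⟩
      ∑₂ (Δt t) (N⊗ G) + ∑₂ (Δt t) (λ as bs → ∑₂ (Δ ts) (N⊗ (λ as′ bs′ → F (as ++ as′) (bs ++ bs′))))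
        ≈⟨ ∑-+ (Δt t) _ _ ⟨
      ∑₂ (Δt t) (λ as bs → N⊗ G as bs + ∑₂ (Δ ts) (N⊗ (λ as′ bs′ → F (as ++ as′) (bs ++ bs′))))
        ≈⟨ ∑-cong (Δt t) (λ { (as , bs) → N⊗-Δ as bs }) ⟩
      ∑₂ (Δt t) (λ as bs → ∑₂ (Δ ts) (λ as′ bs′ → N⊗ F (as ++ as′) (bs ++ bs′)))
        ≈⟨ ∑Δ-∷ (N⊗ F) t ts ⟨
      ∑₂ (Δ (t ∷ ts)) (N⊗ F) ∎
      where
      G : Forest → Forest → Carrier
      G as bs = ∑₂ (Δ ts) (λ as′ bs′ → F (as ++ as′) (bs ++ bs′))
      N⊗-Δ : ∀ as bs → N⊗ G as bs + ∑₂ (Δ ts) (N⊗ (λ as′ bs′ → F (as ++ as′) (bs ++ bs′)))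
                       ≈ ∑₂ (Δ ts) (λ as′ bs′ → N⊗ F (as ++ as′) (bs ++ bs′))
      N⊗-Δ as bs =
        trans (+-congʳ (N⊗-∑ (λ y as″ bs″ → F (as″ ++ proj₁ y) (bs″ ++ proj₂ y)) (Δ ts) as bs))
              (trans (sym (∑-+ (Δ ts) _ _)) (∑-cong (Δ ts) (λ { (as′ , bs′) → N⊗-++ F-inv as bs as′ bs′ })))

  -- The dual statements

  infixl 7 _⊗_
  _⊗_ : Fn → Fn → Forest → Forest → Carrier
  (w ⊗ v) as bs = ⟪ w , as ⟫ * ⟪ v , bs ⟫

  ⊗-invariant : ∀ w v → Invariant₂ (w ⊗ v)
  ⊗-invariant w v eq eq′ = *-cong (pairing-invariant w eq) (pairing-invariant v eq′)

  -- the sum in `_⋆_` is a local function of Defs; abstracting it in the `with` lets ∑-unique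
  -- identify it without naming it
  ⋆-expansion : ∀ w v u → (w ⋆ v) u ≡ ∑₂ (Δ u) (w ⊗ v)
  ⋆-expansion w v u with Δ u | ∑-unique _ ≡.refl (λ _ _ → ≡.refl)
  ... | L | sum-unique = sum-unique L

  ⋆-pairing : ∀ w v u → ⟪ w ⋆ v , u ⟫ ≈ ∑₂ (Δ u) (w ⊗ v)
  ⋆-pairing w v u = trans (reflexive (⋆-expansion w v (canonF u))) (∑Δ-invariant (⊗-invariant w v) (canonF-≃ u))

  N*-pairing : ∀ w u → ⟪ N* w , u ⟫ ≈ ∑ (graftingsF u) ⟪ w ,_⟫
  N*-pairing w u = trans (N*-expansion w (canonF u)) (∑-graftingsF-invariant (pairing-invariant w) (canonF-≃ u))

  ⊕-pairing : ∀ w v u → ⟪ w ⊕ v , u ⟫ ≡ ⟪ w , u ⟫ + ⟪ v , u ⟫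
  ⊕-pairing w v u = ≡.cong₂ _+_ (pairing-canonF w u) (pairing-canonF v u)

  ⊕-fold-expansion : ∀ {A : Set} (s : List A → Fn) (f : A → Fn) → (∀ u → s [] u ≡ 0#) →
                     (∀ x xs u → s (x ∷ xs) u ≡ ⟪ f x , u ⟫ + ⟪ s xs , u ⟫) →
                     ∀ xs u → s xs u ≈ ∑ xs (λ x → ⟪ f x , u ⟫)
  ⊕-fold-expansion s f s-[] s-∷ [] u = reflexive (s-[] u)
  ⊕-fold-expansion s f s-[] s-∷ (x ∷ xs) u = begin
    s (x ∷ xs) u                                    ≡⟨ s-∷ x xs u ⟩
    ⟪ f x , u ⟫ + s xs (canonF u)                   ≈⟨ +-congˡ (⊕-fold-expansion s f s-[] s-∷ xs (canonF u)) ⟩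
    ⟪ f x , u ⟫ + ∑ xs (λ x → ⟪ f x , canonF u ⟫)   ≡⟨ ≡.cong (⟪ f x , u ⟫ +_) (∑-cong-≡ xs (λ x → pairing-canonF (f x) u)) ⟩
    ⟪ f x , u ⟫ + ∑ xs (λ x → ⟪ f x , u ⟫)          ∎

  -- as in ⋆-expansion, for the local fold defining ΣnZ
  ΣnZ-expansion : ∀ t u → ΣnZ t u ≈ ∑ (treesOfSize (size t ∸ 1)) (λ t′ → natK K (nCoef t′ t) * ⟪ Z t′ , u ⟫)
  ΣnZ-expansion t with treesOfSize (size t ∸ 1)
                     | ⊕-fold-expansion _ (λ t′ → natK K (nCoef t′ t) · Z t′) (λ _ → ≡.refl) (λ _ _ _ → ≡.refl)
  ... | ts | fold-expansion = λ u →
    trans (fold-expansion ts u) (reflexive (∑-cong-≡ ts (λ t′ → ≡.cong (natK K (nCoef t′ t) *_) (pairing-canonF (Z t′) u))))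

  Z-pairing : ∀ t us → ⟪ Z t , us ⟫ ≡ Z t us
  Z-pairing t us = ≡.cong (λ vs → if eqB (codeF vs) (codeF (canonF [ t ])) then 1# else 0#) (canonF-idem us)

  Z-[] : ∀ t → Z t [] ≡ 0#
  Z-[] t = ≡.cong (λ b → if b then 1# else 0#) ([]≅Fᵇ[-] t)

  Z-[-] : ∀ t s → Z t [ s ] ≡ (if s ≅ᵇ t then 1# else 0#)
  Z-[-] t s = ≡.cong (λ b → if b then 1# else 0#) ([-]≅Fᵇ[-] s t)

  Z-length : ∀ t {us} → length us ≢ 1 → Z t us ≡ 0#
  Z-length t {us} length≢1 with us ≅Fᵇ [ t ] in eq
  ... | true = contradiction (≅Fᵇ-length {us} {[ t ]} eq) length≢1
  ... | false = ≡.refl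

  ∑-graftings-Z : ∀ t s → Canonical s →
    ∑ (graftings s) (λ s′ → Z t [ s′ ]) ≈ ∑ (treesOfSize (size t ∸ 1)) (λ t′ → natK K (nCoef t′ t) * Z t′ [ s ])
  ∑-graftings-Z t s s-canonical = begin
    ∑ (graftings s) (λ s′ → Z t [ s′ ])
      ≡⟨ ∑-cong-≡ (graftings s) (λ s′ → Z-[-] t s′) ⟩
    ∑ (graftings s) (λ s′ → if s′ ≅ᵇ t then 1# else 0#)
      ≈⟨ by-size (size s ℕ.≟ size t ∸ 1) ⟩
    ∑ (treesOfSize (size t ∸ 1)) (λ t′ → if s ≅ᵇ t′ then natK K (nCoef t′ t) else 0#)
      ≈⟨ ∑-cong (treesOfSize (size t ∸ 1)) (λ t′ → trans (sym (*-indicator _ (s ≅ᵇ t′))) (*-congˡ (reflexive (≡.sym (Z-[-] t′ s))))) ⟩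
    ∑ (treesOfSize (size t ∸ 1)) (λ t′ → natK K (nCoef t′ t) * Z t′ [ s ]) ∎
    where
    by-size : Dec (size s ≡ size t ∸ 1) →
              ∑ (graftings s) (λ s′ → if s′ ≅ᵇ t then 1# else 0#)
                ≈ ∑ (treesOfSize (size t ∸ 1)) (λ t′ → if s ≅ᵇ t′ then natK K (nCoef t′ t) else 0#)
    by-size (yes size≡) = begin
      ∑ (graftings s) (λ s′ → if s′ ≅ᵇ t then 1# else 0#)  ≈⟨ ∑-count (_≅ᵇ t) (graftings s) ⟩
      natK K (nCoef s t)                                   ≡⟨ ≡.cong (λ s′ → natK K (nCoef s′ t)) s-canonical ⟨
      natK K (nCoef (canon s) t)                           ≈⟨ ∑-treesOfSize-≅ᵇ (λ t′ → natK K (nCoef t′ t)) s size≡ ⟨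
      ∑ (treesOfSize (size t ∸ 1)) (λ t′ → if s ≅ᵇ t′ then natK K (nCoef t′ t) else 0#) ∎
    by-size (no size≢) = trans
      (∑-zero (All.map (λ {s′} size-s′ → reflexive (≡.cong (λ b → if b then 1# else 0#)
                 (≅ᵇ-false λ size≡ → size≢ (≡.cong (_∸ 1) (≡.trans (≡.sym size-s′) size≡))))) (graftings-size s)))
      (sym (∑-zero (All.map (λ {t′} size-t′ → reflexive (≡.cong (λ b → if b then natK K (nCoef t′ t) else 0#)
                 (≅ᵇ-false λ size≡ → size≢ (≡.trans size≡ size-t′)))) (treesOfSize-size (size t ∸ 1)))))

  ∑-graftingsF-Z : ∀ t {us} → All Canonical us →
    ∑ (graftingsF us) (Z t) ≈ ∑ (treesOfSize (size t ∸ 1)) (λ t′ → natK K (nCoef t′ t) * Z t′ us)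
  ∑-graftingsF-Z t [] =
    sym (∑-zero (All.universal (λ t′ → trans (*-congˡ (reflexive (Z-[] t′))) (zeroʳ _)) (treesOfSize (size t ∸ 1))))
  ∑-graftingsF-Z t {s ∷ []} (s-canonical ∷ []) = trans (∑-graftingsF-[-] (Z t) s) (∑-graftings-Z t s s-canonical)
  ∑-graftingsF-Z t {us@(_ ∷ _ ∷ _)} _ = trans
    (∑-zero (All.map (λ {g} length≡ → reflexive (Z-length t {g} (λ length≡1 → 1+1+n≢1 (≡.trans (≡.sym length≡) length≡1))))
                     (graftingsF-length us)))
    (sym (∑-zero (All.universal (λ t′ → trans (*-congˡ (reflexive (Z-length t′ {us} 1+1+n≢1))) (zeroʳ _)) (treesOfSize (size t ∸ 1)))))
    where
    1+1+n≢1 : ∀ {n} → suc (suc n) ≢ 1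
    1+1+n≢1 ()

  N*-Z : ∀ t → N* (Z t) ≐ ΣnZ t
  N*-Z t u = begin
    N* (Z t) (canonF u)
      ≈⟨ N*-expansion (Z t) (canonF u) ⟩
    ∑ (graftingsF (canonF u)) ⟪ Z t ,_⟫
      ≡⟨ ∑-cong-≡ (graftingsF (canonF u)) (Z-pairing t) ⟩
    ∑ (graftingsF (canonF u)) (Z t)
      ≈⟨ ∑-graftingsF-Z t (canonF-canonical u) ⟩
    ∑ (treesOfSize (size t ∸ 1)) (λ t′ → natK K (nCoef t′ t) * Z t′ (canonF u))
      ≡⟨ ∑-cong-≡ (treesOfSize (size t ∸ 1)) (λ t′ → ≡.cong (natK K (nCoef t′ t) *_) (Z-pairing t′ (canonF u))) ⟨
    ∑ (treesOfSize (size t ∸ 1)) (λ t′ → natK K (nCoef t′ t) * ⟪ Z t′ , canonF u ⟫)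
      ≈⟨ ΣnZ-expansion t (canonF u) ⟨
    ΣnZ t (canonF u) ∎

  counit : Forest → Carrier
  counit [] = 1#
  counit (_ ∷ _) = 0#

  δ• : Forest → Carrier
  δ• (node [] ∷ []) = 1#
  δ• _ = 0#

  counit-++ : ∀ as as′ → counit (as ++ as′) ≈ counit as * counit as′
  counit-++ [] as′ = sym (*-identityˡ _)
  counit-++ (_ ∷ _) as′ = sym (zeroˡ _)

  δ•-++ : ∀ as as′ → δ• (as ++ as′) ≈ δ• as * counit as′ + counit as * δ• as′
  δ•-++ [] as′ = sym (trans (+-cong (zeroˡ _) (*-identityˡ _)) (+-identityˡ _))
  δ•-++ (node [] ∷ []) [] = sym (trans (+-cong (*-identityˡ _) (zeroˡ _)) (+-identityʳ _))
  δ•-++ (node [] ∷ []) (_ ∷ _) = sym (trans (+-cong (zeroʳ _) (zeroˡ _)) (+-identityʳ _))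
  δ•-++ (node [] ∷ _ ∷ _) as′ = sym (trans (+-cong (zeroˡ _) (zeroˡ _)) (+-identityʳ _))
  δ•-++ (node (_ ∷ _) ∷ _) as′ = sym (trans (+-cong (zeroˡ _) (zeroˡ _)) (+-identityʳ _))

  Z•-pairing : ∀ as → ⟪ Z • , as ⟫ ≈ δ• as
  Z•-pairing as = trans (reflexive (Z-pairing • as)) (Z•≈δ• as)
    where
    Z•≈δ• : ∀ as → Z • as ≈ δ• as
    Z•≈δ• [] = reflexive (Z-[] •)
    Z•≈δ• (node [] ∷ []) = refl
    Z•≈δ• (s@(node (node _ ∷ _)) ∷ []) = reflexive (≡.trans (Z-[-] • s) (≡.cong (λ b → if b then 1# else 0#) (≅ᵇ-false {s} {•} λ ())))
    Z•≈δ• as@(node [] ∷ _ ∷ _) = reflexive (Z-length • {as} λ ())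
    Z•≈δ• as@(node (_ ∷ _) ∷ _ ∷ _) = reflexive (Z-length • {as} λ ())

  mutual
    ∑Δt-counit : ∀ t (Ψ : Forest → Carrier) → ∑₂ (Δt t) (λ as bs → counit as * Ψ bs) ≈ Ψ [ t ]
    ∑Δt-counit (node ts) Ψ =
      trans (∑Δt-node _ ts) (trans (+-cong (zeroˡ _) (∑Δ-counit ts (λ bs → Ψ [ node bs ]))) (+-identityˡ _))

    ∑Δ-counit : ∀ ts (Φ : Forest → Carrier) → ∑₂ (Δ ts) (λ as bs → counit as * Φ bs) ≈ Φ ts
    ∑Δ-counit [] Φ = trans (+-identityʳ _) (*-identityˡ _)
    ∑Δ-counit (t ∷ ts) Φ = begin
      ∑₂ (Δ (t ∷ ts)) (λ as bs → counit as * Φ bs)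
        ≈⟨ ∑Δ-∷ _ t ts ⟩
      ∑₂ (Δt t) (λ as bs → ∑₂ (Δ ts) (λ as′ bs′ → counit (as ++ as′) * Φ (bs ++ bs′)))
        ≈⟨ ∑-cong (Δt t) (λ { (as , bs) → split as bs }) ⟩
      ∑₂ (Δt t) (λ as bs → counit as * Φ (bs ++ ts))
        ≈⟨ ∑Δt-counit t (λ bs → Φ (bs ++ ts)) ⟩
      Φ (t ∷ ts) ∎
      where
      split : ∀ as bs → ∑₂ (Δ ts) (λ as′ bs′ → counit (as ++ as′) * Φ (bs ++ bs′)) ≈ counit as * Φ (bs ++ ts)
      split as bs = begin
        ∑₂ (Δ ts) (λ as′ bs′ → counit (as ++ as′) * Φ (bs ++ bs′))
          ≈⟨ ∑-cong (Δ ts) (λ { (as′ , bs′) → trans (*-congʳ (counit-++ as as′)) (*-assoc _ _ _) }) ⟩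
        ∑₂ (Δ ts) (λ as′ bs′ → counit as * (counit as′ * Φ (bs ++ bs′)))
          ≈⟨ ∑-*ˡ (counit as) (Δ ts) _ ⟨
        counit as * ∑₂ (Δ ts) (λ as′ bs′ → counit as′ * Φ (bs ++ bs′))
          ≈⟨ *-congˡ (∑Δ-counit ts (λ bs′ → Φ (bs ++ bs′))) ⟩
        counit as * Φ (bs ++ ts) ∎

  mutual
    ∑Δt-δ• : ∀ t (Ψ : Forest → Carrier) →
      ∑₂ (Δt t) (λ as bs → δ• as * Ψ bs) ≈ ∑ (if isTerminal t then [ [] ] else []) Ψ + ∑ (prunings t) (λ s → Ψ [ s ])
    ∑Δt-δ• (node []) Ψ =
      trans (+-cong (*-identityˡ _) (trans (+-congʳ (zeroˡ _)) (+-identityˡ _))) (sym (+-identityʳ _))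
    ∑Δt-δ• t@(node ts@(_ ∷ _)) Ψ = begin
      ∑₂ (Δt t) (λ as bs → δ• as * Ψ bs)
        ≈⟨ ∑Δt-node _ ts ⟩
      0# * Ψ [] + ∑₂ (Δ ts) (λ as bs → δ• as * Ψ [ node bs ])
        ≈⟨ +-cong (zeroˡ _) (∑Δ-δ• ts (λ bs → Ψ [ node bs ])) ⟩
      0# + ∑ (pruningsF ts) (λ g → Ψ [ node g ])
        ≡⟨ ≡.cong (0# +_) (∑-map node (pruningsF ts) (λ s → Ψ [ s ])) ⟨
      0# + ∑ (prunings t) (λ s → Ψ [ s ]) ∎

    ∑Δ-δ• : ∀ ts (Φ : Forest → Carrier) → ∑₂ (Δ ts) (λ as bs → δ• as * Φ bs) ≈ ∑ (pruningsF ts) Φ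
    ∑Δ-δ• [] Φ = trans (+-identityʳ _) (zeroˡ _)
    ∑Δ-δ• (t ∷ ts) Φ = begin
      ∑₂ (Δ (t ∷ ts)) (λ as bs → δ• as * Φ bs)
        ≈⟨ ∑Δ-∷ _ t ts ⟩
      ∑₂ (Δt t) (λ as bs → ∑₂ (Δ ts) (λ as′ bs′ → δ• (as ++ as′) * Φ (bs ++ bs′)))
        ≈⟨ ∑-cong (Δt t) (λ { (as , bs) → split as bs }) ⟩
      ∑₂ (Δt t) (λ as bs → δ• as * Φ (bs ++ ts) + counit as * ∑ (pruningsF ts) (λ g → Φ (bs ++ g)))
        ≈⟨ ∑-+ (Δt t) _ _ ⟩
      ∑₂ (Δt t) (λ as bs → δ• as * Φ (bs ++ ts)) + ∑₂ (Δt t) (λ as bs → counit as * ∑ (pruningsF ts) (λ g → Φ (bs ++ g)))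
        ≈⟨ +-cong (∑Δt-δ• t (λ bs → Φ (bs ++ ts))) (∑Δt-counit t (λ bs → ∑ (pruningsF ts) (λ g → Φ (bs ++ g)))) ⟩
      (∑ (if isTerminal t then [ [] ] else []) (λ g → Φ (g ++ ts)) + ∑ (prunings t) (λ s → Φ (s ∷ ts)))
        + ∑ (pruningsF ts) (λ g → Φ (t ∷ g))
        ≈⟨ ∑-pruningsF-∷ Φ t ts ⟨
      ∑ (pruningsF (t ∷ ts)) Φ ∎
      where
      split : ∀ as bs → ∑₂ (Δ ts) (λ as′ bs′ → δ• (as ++ as′) * Φ (bs ++ bs′))
                        ≈ δ• as * Φ (bs ++ ts) + counit as * ∑ (pruningsF ts) (λ g → Φ (bs ++ g))
      split as bs = begin
        ∑₂ (Δ ts) (λ as′ bs′ → δ• (as ++ as′) * Φ (bs ++ bs′))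
          ≈⟨ ∑-cong (Δ ts) (λ { (as′ , bs′) → trans (*-congʳ (δ•-++ as as′))
               (trans (distribʳ _ _ _) (+-cong (*-assoc _ _ _) (*-assoc _ _ _))) }) ⟩
        ∑₂ (Δ ts) (λ as′ bs′ → δ• as * (counit as′ * Φ (bs ++ bs′)) + counit as * (δ• as′ * Φ (bs ++ bs′)))
          ≈⟨ trans (∑-+ (Δ ts) _ _) (+-cong (sym (∑-*ˡ (δ• as) (Δ ts) _)) (sym (∑-*ˡ (counit as) (Δ ts) _))) ⟩
        δ• as * ∑₂ (Δ ts) (λ as′ bs′ → counit as′ * Φ (bs ++ bs′)) + counit as * ∑₂ (Δ ts) (λ as′ bs′ → δ• as′ * Φ (bs ++ bs′))
          ≈⟨ +-cong (*-congˡ (∑Δ-counit ts (λ bs′ → Φ (bs ++ bs′)))) (*-congˡ (∑Δ-δ• ts (λ bs′ → Φ (bs ++ bs′)))) ⟩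
        δ• as * Φ (bs ++ ts) + counit as * ∑ (pruningsF ts) (λ g → Φ (bs ++ g)) ∎

  P*-Z•⋆ : ∀ w → P* w ≐ Z • ⋆ w
  P*-Z•⋆ w u = begin
    P* w (canonF u)
      ≈⟨ P*-expansion w (canonF u) ⟩
    ∑ (pruningsF (canonF u)) ⟪ w ,_⟫
      ≈⟨ ∑Δ-δ• (canonF u) ⟪ w ,_⟫ ⟨
    ∑₂ (Δ (canonF u)) (λ as bs → δ• as * ⟪ w , bs ⟫)
      ≈⟨ ∑-cong (Δ (canonF u)) (λ { (as , bs) → *-congʳ (sym (Z•-pairing as)) }) ⟩
    ∑₂ (Δ (canonF u)) (Z • ⊗ w)
      ≡⟨ ⋆-expansion (Z •) w (canonF u) ⟨
    (Z • ⋆ w) (canonF u) ∎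

  Homogeneous-natK : ∀ {d v} → Homogeneous d v → ∀ bs → natK K d * ⟪ v , bs ⟫ ≈ natK K (sizeF bs) * ⟪ v , bs ⟫
  Homogeneous-natK {d} {v} v-homogeneous bs with sizeF bs ℕ.≟ d
  ... | yes ≡.refl = refl
  ... | no size≢d = trans (*-congˡ (v-homogeneous bs size≢d))
                          (trans (zeroʳ _) (sym (trans (*-congˡ (v-homogeneous bs size≢d)) (zeroʳ _))))

  N⊗-⊗ : ∀ w v {d} → Homogeneous d v → ∀ as bs →
    N⊗ (w ⊗ v) as bs ≈ ((N* w ⊗ v) as bs + (w ⊗ N* v) as bs) + (∂/∂Z• w ⊗ (natK K d · v)) as bs
  N⊗-⊗ w v {d} v-homogeneous as bs = +-cong (+-cong N*-left N*-right) grafting-at-root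
    where
    N*-left : ∑ (graftingsF as) (λ as′ → ⟪ w , as′ ⟫ * ⟪ v , bs ⟫) ≈ ⟪ N* w , as ⟫ * ⟪ v , bs ⟫
    N*-left = sym (trans (*-congʳ (N*-pairing w as)) (∑-*ʳ ⟪ v , bs ⟫ (graftingsF as) ⟪ w ,_⟫))
    N*-right : ∑ (graftingsF bs) (λ bs′ → ⟪ w , as ⟫ * ⟪ v , bs′ ⟫) ≈ ⟪ w , as ⟫ * ⟪ N* v , bs ⟫
    N*-right = sym (trans (*-congˡ (N*-pairing v bs)) (∑-*ˡ ⟪ w , as ⟫ (graftingsF bs) ⟪ v ,_⟫))
    grafting-at-root : natK K (sizeF bs) * (⟪ w , • ∷ as ⟫ * ⟪ v , bs ⟫) ≈ ⟪ ∂/∂Z• w , as ⟫ * ⟪ natK K d · v , bs ⟫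
    grafting-at-root = begin
      natK K (sizeF bs) * (⟪ w , • ∷ as ⟫ * ⟪ v , bs ⟫)  ≈⟨ *.x∙yz≈y∙xz _ _ _ ⟨
      ⟪ w , • ∷ as ⟫ * (natK K (sizeF bs) * ⟪ v , bs ⟫)  ≈⟨ *-congˡ (Homogeneous-natK {d} {v} v-homogeneous bs) ⟨
      ⟪ w , • ∷ as ⟫ * (natK K d * ⟪ v , bs ⟫)           ≈⟨ *-cong (pairing-invariant w (∷-cong-≃ {•} {•} ≡.refl (canonF-≃ as)))
                                                                   (reflexive (≡.cong (natK K d *_) (pairing-canonF v bs))) ⟨
      ⟪ ∂/∂Z• w , as ⟫ * ⟪ natK K d · v , bs ⟫           ∎

  N*-⋆ : ∀ w v {d} → Homogeneous d v → N* (w ⋆ v) ≐ ((N* w ⋆ v) ⊕ (w ⋆ N* v)) ⊕ (∂/∂Z• w ⋆ (natK K d · v))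
  N*-⋆ w v {d} v-homogeneous u = begin
    ⟪ N* (w ⋆ v) , u ⟫
      ≈⟨ N*-pairing (w ⋆ v) u ⟩
    ∑ (graftingsF u) ⟪ w ⋆ v ,_⟫
      ≈⟨ ∑-cong (graftingsF u) (⋆-pairing w v) ⟩
    ∑ (graftingsF u) (λ g → ∑₂ (Δ g) (w ⊗ v))
      ≈⟨ ∑Δ-graftingsF (⊗-invariant w v) u ⟩
    ∑₂ (Δ u) (N⊗ (w ⊗ v))
      ≈⟨ ∑-cong (Δ u) (λ { (as , bs) → N⊗-⊗ w v v-homogeneous as bs }) ⟩
    ∑₂ (Δ u) (λ as bs → ((N* w ⊗ v) as bs + (w ⊗ N* v) as bs) + (∂/∂Z• w ⊗ (natK K d · v)) as bs)
      ≈⟨ trans (∑-+ (Δ u) _ _) (+-congʳ (∑-+ (Δ u) _ _)) ⟩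
    (∑₂ (Δ u) (N* w ⊗ v) + ∑₂ (Δ u) (w ⊗ N* v)) + ∑₂ (Δ u) (∂/∂Z• w ⊗ (natK K d · v))
      ≈⟨ +-cong (+-cong (⋆-pairing (N* w) v u) (⋆-pairing w (N* v) u)) (⋆-pairing (∂/∂Z• w) (natK K d · v) u) ⟨
    (⟪ N* w ⋆ v , u ⟫ + ⟪ w ⋆ N* v , u ⟫) + ⟪ ∂/∂Z• w ⋆ (natK K d · v) , u ⟫
      ≡⟨ ≡.trans (⊕-pairing ((N* w ⋆ v) ⊕ (w ⋆ N* v)) (∂/∂Z• w ⋆ (natK K d · v)) u)
                 (≡.cong (_+ ⟪ ∂/∂Z• w ⋆ (natK K d · v) , u ⟫) (⊕-pairing (N* w ⋆ v) (w ⋆ N* v) u)) ⟨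
    ⟪ ((N* w ⋆ v) ⊕ (w ⋆ N* v)) ⊕ (∂/∂Z• w ⋆ (natK K d · v)) , u ⟫ ∎

-- Pairings are finite sums in this encoding.
proposition3p6 : ∀ {c ℓ : Level} (K : CommutativeRing c ℓ) → IsField0 K →
    let open Dual K in
      (N* (Z •) ≐ 0ᴰ)
      × (∀ (t : Tree) → 2 ≤ size t → N* (Z t) ≐ ΣnZ t)
      × (∀ (w v : Fn) (d : ℕ) → IsGraded w → IsGraded v → Homogeneous d v →
           N* (w ⋆ v) ≐ (((N* w) ⋆ v) ⊕ (w ⋆ (N* v))) ⊕ ((∂/∂Z• w) ⋆ (natK K d · v)))
      × (∀ (w : Fn) → IsGraded w → P* w ≐ (Z • ⋆ w))
proposition3p6 K _ =
  N*-Z K • , (λ t _ → N*-Z K t) , (λ w v d _ _ → N*-⋆ K w v) , (λ w _ → P*-Z•⋆ K w)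
  where open Transposes
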